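{- Let $a_1,a_2,a_3$ be pairwise coprime positive integers, let $L=\{\mathbf{x}\in\mathbb{Z}^3: a_1x_1+a_2x_2+a_3x_3=0\}$, and let $l_i$, $x_{ij}$ and $\mathbf{f}_1,\mathbf{f}_2,\mathbf{f}_3$ be as in the context, with $l_i\ge 2$ for $i=1,2,3$. Let $(\mathbf{u},\mathbf{v})$ be a reduced basis of $L$ with respect to the norm $|\mathbf{x}|=\sqrt{\mathbf{x}^TQ\mathbf{x}}$, where $$Q=\begin{pmatrix}a_1^2&-a_1a_2&0\\-a_1a_2&a_2^2&0\\0&0&3a_3^2\end{pmatrix}.$$ Assume $\mathbf{u}=(u_1,u_2,u_3)$ satisfies $u_1\le 0$, $u_2\le 0$, $u_3>0$, and put $\lambda:=v_3/u_3$, where $\mathbf{v}=(v_1,v_2,v_3)$. Then the three vectors $$\mathbf{u},\qquad \mathbf{v}_-:=\mathbf{v}-\lceil\lambda\rceil\mathbf{u},\qquad \mathbf{v}_+:=\mathbf{v}-\lfloor\lambda\rfloor\mathbf{u}$$ form a solution basis, i.e. there are signs $\varepsilon_1,\varepsilon_2,\varepsilon_3\in\{\pm1\}$ with $\{\mathbf{u},\mathbf{v}_-,\mathbf{v}_+\}=\{\varepsilon_1\mathbf{f}_1,\varepsilon_2\mathbf{f}_2,\varepsilon_3\mathbf{f}_3\}$.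
   Context: $\mathbb{N}=\{0,1,2,\dots\}$; $T(b,c)=\{xb+yc: x,y\in\mathbb{N}\}$. For $i\in\{1,2,3\}$ and $\{j,k\}=\{1,2,3\}\setminus\{i\}$, $l_i:=\min\{l\in\mathbb{N}_{>0}: la_i\in T(a_j,a_k)\}$, and $x_{ij},x_{ik}\in\mathbb{N}$ are the (under these hypotheses unique) coefficients with $l_ia_i=x_{ij}a_j+x_{ik}a_k$. The basic vectors are $\mathbf{f}_1=(l_1,-x_{12},-x_{13})$, $\mathbf{f}_2=(-x_{21},l_2,-x_{23})$, $\mathbf{f}_3=(-x_{31},-x_{32},l_3)$, all in $L$. The form $\mathbf{x}^TQ\mathbf{x}$ is positive definite on the plane $a_1x_1+a_2x_2+a_3x_3=0$. A reduced basis of $L$ is a basis $(\mathbf{u},\mathbf{v})$ of $L$ such that $\mathbf{u}$ is a shortest nonzero vector of $L$ and $\mathbf{v}$ is a shortest vector of $L\setminus\mathbb{Z}\mathbf{u}$ (for the norm $|\cdot|$). -}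

module Defs where

open import Data.Nat as ℕ using (ℕ; suc)
open import Data.Nat.Coprimality using (Coprime)
open import Data.Integer as ℤ using (ℤ; +_; -[1+_]; _*_; _+_; _-_; -_; _≤_; _<_; 0ℤ; 1ℤ)
open import Data.Rational as ℚ using (ℚ)
open import Data.Product using (_×_; _,_; ∃; ∃-syntax; Σ-syntax)
open import Data.Sum using (_⊎_)
open import Relation.Nullary using (¬_)
open import Relation.Binary.PropositionalEquality using (_≡_; _≢_)
open import Data.List using (List; _∷_; [])
open import Data.List.Membership.Propositional using (_∈_)

Vec3 : Set
Vec3 = ℤ × ℤ × ℤ

zero3 : Vec3
zero3 = (0ℤ , 0ℤ , 0ℤ)

_⊕_ : Vec3 → Vec3 → Vec3
(x₁ , x₂ , x₃) ⊕ (y₁ , y₂ , y₃) = (x₁ + y₁ , x₂ + y₂ , x₃ + y₃)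

_·_ : ℤ → Vec3 → Vec3
k · (x₁ , x₂ , x₃) = (k * x₁ , k * x₂ , k * x₃)

_⊖_ : Vec3 → Vec3 → Vec3
x ⊖ y = x ⊕ ((- 1ℤ) · y)

InT : ℕ → ℕ → ℕ → Set
InT b c n = ∃[ x ] ∃[ y ] n ≡ x ℕ.* b ℕ.+ y ℕ.* c

IsMinL : ℕ → ℕ → ℕ → ℕ → Set
IsMinL aᵢ aⱼ aₖ l =
  (0 ℕ.< l) × InT aⱼ aₖ (l ℕ.* aᵢ) ×
  (∀ m → 0 ℕ.< m → InT aⱼ aₖ (m ℕ.* aᵢ) → l ℕ.≤ m)

InL : ℕ → ℕ → ℕ → Vec3 → Set
InL a₁ a₂ a₃ (x₁ , x₂ , x₃) = (+ a₁) * x₁ + (+ a₂) * x₂ + (+ a₃) * x₃ ≡ 0ℤ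

-- |x|² = xᵀ Q x with Q = [[a₁², -a₁a₂, 0], [-a₁a₂, a₂², 0], [0, 0, 3a₃²]]
normSq : ℕ → ℕ → ℕ → Vec3 → ℤ
normSq a₁ a₂ a₃ (x₁ , x₂ , x₃) =
  let A₁ = + a₁ ; A₂ = + a₂ ; A₃ = + a₃ in
  A₁ * A₁ * x₁ * x₁ - (+ 2) * A₁ * A₂ * x₁ * x₂ + A₂ * A₂ * x₂ * x₂
    + (+ 3) * A₃ * A₃ * x₃ * x₃

InZMult : Vec3 → Vec3 → Set
InZMult u w = ∃[ k ] w ≡ k · u

IsBasisL : ℕ → ℕ → ℕ → Vec3 → Vec3 → Set
IsBasisL a₁ a₂ a₃ u v =
  InL a₁ a₂ a₃ u × InL a₁ a₂ a₃ v ×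
  (∀ w → InL a₁ a₂ a₃ w → ∃[ m ] ∃[ n ] w ≡ (m · u) ⊕ (n · v)) ×
  (∀ m n → (m · u) ⊕ (n · v) ≡ zero3 → m ≡ 0ℤ × n ≡ 0ℤ)

IsReducedBasis : ℕ → ℕ → ℕ → Vec3 → Vec3 → Set
IsReducedBasis a₁ a₂ a₃ u v =
  IsBasisL a₁ a₂ a₃ u v ×
  (u ≢ zero3) ×
  (∀ w → InL a₁ a₂ a₃ w → w ≢ zero3 → normSq a₁ a₂ a₃ u ≤ normSq a₁ a₂ a₃ w) ×
  (¬ InZMult u v) ×
  (∀ w → InL a₁ a₂ a₃ w → ¬ InZMult u w → normSq a₁ a₂ a₃ v ≤ normSq a₁ a₂ a₃ w)

-- the rational number p / q for q > 0 (junk value 0 when q ≤ 0; only used with q > 0)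
ratio : ℤ → ℤ → ℚ
ratio p (+ suc n) = p ℚ./ suc n
ratio p _ = ℚ.0ℚ

IsSign : ℤ → Set
IsSign ε = ε ≡ 1ℤ ⊎ ε ≡ - 1ℤ

SameSet : List Vec3 → List Vec3 → Set
SameSet xs ys = (∀ z → z ∈ xs → z ∈ ys) × (∀ z → z ∈ ys → z ∈ xs)

module Submission where

-- Proof strategy (f₁, f₂, f₃ the basic vectors, L the lattice, (u, v) the reduced basis).
--  1. Herzog's identities (`HerzogIdentities.herzog`): as all lᵢ ≥ 2, Bézout gives lᵢ < aⱼ, so every
--     xᵢⱼ > 0; minimality then gives xₖⱼ < lⱼ and lᵢ ≤ xⱼᵢ + xₖᵢ, and comparing Σ lᵢaᵢ with
--     Σ (xⱼᵢ + xₖᵢ)aᵢ forces lᵢ = xⱼᵢ + xₖᵢ, i.e. f₁ + f₂ + f₃ = 0.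
--  2. f₃ and f₁ generate L (`Setting.generated`): subtracting fᵢ from a vector of L whose only
--     positive coordinate is the i-th lowers its weighted size Σ |wᵢ|aᵢ (`SizeStep.size-step`), and
--     up to sign every nonzero vector of L has this shape.
--  3. u = f₃ (`Setting.shortest-is-f₃`): on L the norm is 4(p² + pq + q²) with p = a₁x₁, q = a₂x₂,
--     so u₃ > l₃ would make u - f₃ shorter; hence u₃ = l₃ by minimality, and the representation of
--     l₃a₃ in T(a₁,a₂) is unique (`UniqueRepresentation`).
--  4. From v = α·f₃ + β·f₁ and f₁ = m·f₃ + n·v, independence of f₁, f₃ gives nβ = 1, so β = ±1; then
--     v₃ = α·l₃ ∓ x₁₃ lies strictly between consecutive multiples of l₃, which fixes ⌊λ⌋ and ⌈λ⌉
--     (`Rounding.rounding`), and v₋, v₊ come out as ±f₁, ±f₂ (`Setting.solution-basis`).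

open import Data.Nat as ℕ using (ℕ)
open import Relation.Binary.PropositionalEquality using (_≡_)

module Minimality where

  open import Data.Nat
  open import Data.Nat.Properties
  open import Data.Nat.Divisibility using (divides; ∣⇒≤)
  open import Data.Nat.Coprimality using (Coprime; coprime-divisor)
  open import Data.Product using (_,_)
  open import Relation.Binary.PropositionalEquality
  open import Defs using (IsMinL)

  private variable
    ai aj ak li : ℕ

  LowerBound : ℕ → ℕ → ℕ → ℕ → Set
  LowerBound ai aj ak l = ∀ m x y → 0 < m → m * ai ≡ x * aj + y * ak → l ≤ m

  lowerBound : IsMinL ai aj ak li → LowerBound ai aj ak li
  lowerBound (_ , _ , least) m x y m>0 eq = least m m>0 (x , y , eq)

  lowerBound-swap : IsMinL ai aj ak li → LowerBound ai ak aj li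
  lowerBound-swap {ai} {aj} {ak} (_ , _ , least) m x y m>0 eq =
    least m m>0 (y , x , trans eq (+-comm (x * ak) (y * aj)))

  coprime-multiple : ∀ {a b m x} → Coprime a b → 0 < m → m * b ≡ x * a → a ≤ m
  coprime-multiple {a} {b} {m} {x} cop m>0 eq =
    ∣⇒≤ {{>-nonZero m>0}} (coprime-divisor cop (divides x (trans (*-comm b m) eq)))


module CoprimeResidues where

  open import Data.Nat as ℕ using (ℕ; zero; suc; z<s)
  import Data.Nat.Properties as ℕP
  open import Data.Nat.Coprimality using (Coprime; coprime-Bézout)
  open import Data.Nat.GCD using (module Bézout)
  open import Data.Integer hiding (suc)
  open import Data.Integer.Properties
  open import Data.Integer.DivMod using (a≡a%ℕn+[a/ℕn]*n; n%ℕd<d)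
  open import Data.Integer.Tactic.RingSolver using (solve-∀)
  open import Data.Product using (∃-syntax; _×_; _,_)
  open import Data.Empty using (⊥-elim)
  open import Relation.Binary.PropositionalEquality
  open Minimality using (LowerBound)

  cast-identity : ∀ {m n p q} → 1 ℕ.+ m ℕ.* n ≡ p ℕ.* q → 1ℤ + + m * + n ≡ + p * + q
  cast-identity {m} {n} {p} {q} eq = begin
    1ℤ + + m * + n        ≡⟨ cong (λ z → 1ℤ + z) (pos-* m n) ⟨
    1ℤ + + (m ℕ.* n)      ≡⟨ pos-+ 1 (m ℕ.* n) ⟨
    + (1 ℕ.+ m ℕ.* n)     ≡⟨ cong +_ eq ⟩
    + (p ℕ.* q)           ≡⟨ pos-* p q ⟩
    + p * + q             ∎
    where open ≡-Reasoning

  bézout : ∀ {a b} → Coprime a b → ∃[ X ] ∃[ Y ] X * + a + Y * + b ≡ 1ℤ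
  bézout {a} {b} cop with coprime-Bézout cop
  ... | Bézout.+- x y eq = + x , - + y ,
    trans (cong (_+ - + y * + b) (sym (cast-identity {y} {b} {x} {a} eq))) (cancel (+ y) (+ b))
    where
      cancel : ∀ u v → 1ℤ + u * v + - u * v ≡ 1ℤ
      cancel = solve-∀
  ... | Bézout.-+ x y eq = - + x , + y ,
    trans (cong (λ z → - + x * + a + z) (sym (cast-identity {x} {a} {y} {b} eq))) (cancel (+ x) (+ a))
    where
      cancel : ∀ u v → - u * v + (1ℤ + u * v) ≡ 1ℤ
      cancel = solve-∀

  bounded-multiple : ∀ {a b} c → Coprime a b → ℕ.NonZero b →
                     ∃[ r ] ∃[ t ] r ℕ.< b × + r * + a ≡ + c + t * + b
  bounded-multiple {a} {b} c cop b≢0 with bézout cop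
  ... | X , Y , XY = r , - (+ c * Y) - q * + a , n%ℕd<d M b , (begin
    + r * + a                           ≡⟨ cong (_* + a) (split M (+ r) (q * + b) (a≡a%ℕn+[a/ℕn]*n M b)) ⟩
    (+ c * X - q * + b) * + a           ≡⟨ regroup (+ c) X Y q (+ a) (+ b) ⟩
    + c * (X * + a + Y * + b) + (- (+ c * Y) - q * + a) * + b
                                        ≡⟨ cong (λ z → + c * z + (- (+ c * Y) - q * + a) * + b) XY ⟩
    + c * 1ℤ + (- (+ c * Y) - q * + a) * + b ≡⟨ cong (_+ (- (+ c * Y) - q * + a) * + b) (*-identityʳ (+ c)) ⟩
    + c + (- (+ c * Y) - q * + a) * + b ∎)
    where
      instance _ = b≢0
      open ≡-Reasoning
      M : ℤ
      M = + c * X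
      r : ℕ
      r = M %ℕ b
      q : ℤ
      q = M /ℕ b
      split : ∀ m s t → m ≡ s + t → s ≡ m - t
      split m s t eq = trans (cancel s t) (cong (_- t) (sym eq))
        where cancel : ∀ s t → s ≡ s + t - t
              cancel = solve-∀
      regroup : ∀ C X Y Q A B → (C * X - Q * B) * A ≡ C * (X * A + Y * B) + (- (C * Y) - Q * A) * B
      regroup = solve-∀

  from-ℤ : ∀ m n p q s → + m * + n ≡ + p + + q * + s → m ℕ.* n ≡ p ℕ.+ q ℕ.* s
  from-ℤ m n p q s eq = +-injective (begin
    + (m ℕ.* n)             ≡⟨ pos-* m n ⟩
    + m * + n               ≡⟨ eq ⟩
    + p + + q * + s         ≡⟨ cong (λ z → + p + z) (pos-* q s) ⟨
    + p + + (q ℕ.* s)       ≡⟨ pos-+ p (q ℕ.* s) ⟨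
    + (p ℕ.+ q ℕ.* s)       ∎)
    where open ≡-Reasoning

  -- lᵢ < aⱼ as soon as aᵢ, aⱼ are coprime and lₖ ≥ 2: pick 0 ≤ r < aⱼ with
  -- r·aᵢ ≡ aₖ (mod aⱼ); either r·aᵢ ∈ T(aⱼ,aₖ), so lᵢ ≤ r, or aₖ ∈ T(aᵢ,aⱼ), so lₖ ≤ 1.
  l<a : ∀ {ai aj ak li lk} → 0 ℕ.< aj → 0 ℕ.< ak → Coprime ai aj →
        LowerBound ai aj ak li → LowerBound ak ai aj lk → 2 ℕ.≤ lk → li ℕ.< aj
  l<a {ai} {aj} {ak} {li} {lk} aj>0 ak>0 cop boundᵢ boundₖ lk≥2 =
    by-residue (bounded-multiple ak cop (ℕ.>-nonZero aj>0))
    where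
      by-residue : (∃[ r ] ∃[ t ] r ℕ.< aj × + r * + ai ≡ + ak + t * + aj) → li ℕ.< aj
      by-residue (zero , + t , _ , eq) =
        ⊥-elim (ℕP.<-irrefl (sym (ℕP.m+n≡0⇒m≡0 ak (sym (from-ℤ 0 ai ak t aj eq)))) ak>0)
      by-residue (suc r , + t , r<aj , eq) =
        ℕP.≤-<-trans (boundᵢ (suc r) t 1 z<s r·aᵢ∈T) r<aj
        where
          r·aᵢ∈T : suc r ℕ.* ai ≡ t ℕ.* aj ℕ.+ 1 ℕ.* ak
          r·aᵢ∈T = trans (from-ℤ (suc r) ai ak t aj eq)
                     (trans (ℕP.+-comm ak (t ℕ.* aj)) (cong (t ℕ.* aj ℕ.+_) (sym (ℕP.*-identityˡ ak))))
      by-residue (r , -[1+ t ] , _ , eq) =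
        ⊥-elim (ℕP.<-irrefl refl (ℕP.<-≤-trans lk≥2 (boundₖ 1 r (suc t) z<s aₖ∈T)))
        where
          rearrange : ∀ R A K T B → R * A ≡ K + (- T) * B → K ≡ R * A + T * B
          rearrange R A K T B e = trans (move K T B) (cong (_+ T * B) (sym e))
            where move : ∀ K T B → K ≡ K + (- T) * B + T * B
                  move = solve-∀
          aₖ∈T : 1 ℕ.* ak ≡ r ℕ.* ai ℕ.+ suc t ℕ.* aj
          aₖ∈T = from-ℤ 1 ak (r ℕ.* ai) (suc t) aj
                     (trans (*-identityˡ (+ ak))
                       (trans (rearrange (+ r) (+ ai) (+ ak) (+ suc t) (+ aj) eq)
                         (cong (_+ + suc t * + aj) (sym (pos-* r ai)))))


module HerzogIdentities where

  open import Data.Nat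
  open import Data.Nat.Properties
  open import Data.Nat.Coprimality using (Coprime) renaming (sym to coprime-sym)
  open import Data.Nat.Tactic.RingSolver using (solve-∀)
  open import Data.Product using (_×_; _,_; proj₁; proj₂)
  open import Data.Empty using (⊥; ⊥-elim)
  open import Relation.Nullary using (yes; no; ¬_)
  open import Relation.Binary.PropositionalEquality
  open import Defs using (IsMinL)
  open Minimality
  open CoprimeResidues using (l<a)

  -- The coefficient x of aⱼ in lᵢaᵢ = x·aⱼ + y·aₖ is positive once lᵢ < aₖ,
  -- since otherwise aₖ would divide lᵢ.
  first-coef-pos : ∀ {ai aj ak li x y} → Coprime ak ai → 0 < li → li < ak →
                   li * ai ≡ x * aj + y * ak → 0 < x
  first-coef-pos {x = suc _} _ _ _ _ = z<s
  first-coef-pos {x = zero} {y} cop li>0 li<ak eq = ⊥-elim (<⇒≱ li<ak (coprime-multiple {x = y} cop li>0 eq))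

  -- A minimal multiple lₖ·aₖ cannot be split as c·aₖ + S with c > 0 and S a positive
  -- element of T(aᵢ,aⱼ): either c ≥ lₖ (too large), or (lₖ - c)·aₖ = S contradicts minimality.
  no-split : ∀ {ak lk c S} → lk * ak ≡ c * ak + S → 0 < S → 0 < c →
             (∀ e → 0 < e → e * ak ≡ S → lk ≤ e) → ⊥
  no-split {ak} {lk} {c} {S} eq S>0 c>0 minimal with c <? lk
  ... | no c≮lk = <-irrefl refl
    (≤-<-trans (*-monoˡ-≤ ak (≮⇒≥ c≮lk)) (<-≤-trans (m<m+n (c * ak) S>0) (≤-reflexive (sym eq))))
  ... | yes c<lk with m≤n⇒∃[o]m+o≡n (<⇒≤ c<lk)
  ... | zero , refl = <-irrefl (sym (+-identityʳ c)) c<lk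
  ... | suc e , refl = <-irrefl refl (<-≤-trans (m<n+m (suc e) c>0) (minimal (suc e) z<s e·aₖ≡S))
    where
      e·aₖ≡S : suc e * ak ≡ S
      e·aₖ≡S = +-cancelˡ-≡ (c * ak) _ _ (trans (sym (*-distribʳ-+ ak c (suc e))) eq)

  -- xₖⱼ < lⱼ: otherwise substituting lⱼaⱼ = xⱼᵢaᵢ + xⱼₖaₖ into lₖaₖ = xₖᵢaᵢ + xₖⱼaⱼ
  -- splits off xⱼₖ·aₖ from lₖaₖ, which `no-split` forbids.
  x<l : ∀ {ai aj ak lj lk xji xjk xki xkj} → 0 < ai →
        lk * ak ≡ xki * ai + xkj * aj → lj * aj ≡ xji * ai + xjk * ak →
        0 < xji → 0 < xjk → LowerBound ak ai aj lk → xkj < lj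
  x<l {ai} {aj} {ak} {lj} {lk} {xji} {xjk} {xki} {xkj} ai>0 Eₖ Eⱼ xji>0 xjk>0 boundₖ with xkj <? lj
  ... | yes lt = lt
  ... | no xkj≮lj with m≤n⇒∃[o]m+o≡n (≮⇒≥ xkj≮lj)
  ... | d , refl = ⊥-elim (no-split split S>0 xjk>0 (λ e e>0 eq → boundₖ e (xki + xji) d e>0 eq))
    where
      open ≡-Reasoning
      S : ℕ
      S = (xki + xji) * ai + d * aj
      split : lk * ak ≡ xjk * ak + S
      split = begin
        lk * ak                                   ≡⟨ Eₖ ⟩
        xki * ai + (lj + d) * aj                  ≡⟨ regroup xki ai lj d aj ⟩
        xki * ai + d * aj + lj * aj               ≡⟨ cong (xki * ai + d * aj +_) Eⱼ ⟩
        xki * ai + d * aj + (xji * ai + xjk * ak) ≡⟨ regroup′ xki ai d aj xji xjk ak ⟩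
        xjk * ak + S                              ∎
        where
          regroup : ∀ a b c d e → a * b + (c + d) * e ≡ a * b + d * e + c * e
          regroup = solve-∀
          regroup′ : ∀ a b c d e f g → a * b + c * d + (e * b + f * g) ≡ f * g + ((a + e) * b + c * d)
          regroup′ = solve-∀
      S>0 : 0 < S
      S>0 = ≤-trans (*-mono-≤ (≤-trans xji>0 (m≤n+m xji xki)) ai>0) (m≤m+n _ _)

  -- lᵢ ≤ xⱼᵢ + xₖᵢ: adding the relations for j and k and cancelling xₖⱼaⱼ ≤ lⱼaⱼ,
  -- xⱼₖaₖ ≤ lₖaₖ exhibits (xⱼᵢ + xₖᵢ)·aᵢ as an element of T(aⱼ,aₖ).
  l≤x+x : ∀ {ai aj ak li lj lk xji xjk xki xkj} →
          lj * aj ≡ xji * ai + xjk * ak → lk * ak ≡ xki * ai + xkj * aj →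
          xkj ≤ lj → xjk ≤ lk → 0 < xji → LowerBound ai aj ak li → li ≤ xji + xki
  l≤x+x {ai} {aj} {ak} {li} {lj} {lk} {xji} {xjk} {xki} {xkj} Eⱼ Eₖ xkj≤lj xjk≤lk xji>0 boundᵢ
    with m≤n⇒∃[o]m+o≡n xkj≤lj | m≤n⇒∃[o]m+o≡n xjk≤lk
  ... | dj , refl | dk , refl =
    boundᵢ (xji + xki) dj dk (≤-trans xji>0 (m≤m+n xji xki)) (+-cancelʳ-≡ _ _ _ sum)
    where
      open ≡-Reasoning
      sum : (xji + xki) * ai + (xkj * aj + xjk * ak) ≡ (dj * aj + dk * ak) + (xkj * aj + xjk * ak)
      sum = begin
        (xji + xki) * ai + (xkj * aj + xjk * ak)      ≡⟨ regroup xji xki ai xkj aj xjk ak ⟩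
        (xji * ai + xjk * ak) + (xki * ai + xkj * aj) ≡⟨ cong₂ _+_ Eⱼ Eₖ ⟨
        (xkj + dj) * aj + (xjk + dk) * ak             ≡⟨ regroup′ xkj aj dj xjk ak dk ⟩
        (dj * aj + dk * ak) + (xkj * aj + xjk * ak)   ∎
        where
          regroup : ∀ a b c d e f g → (a + b) * c + (d * e + f * g) ≡ (a * c + f * g) + (b * c + d * e)
          regroup = solve-∀
          regroup′ : ∀ d e dj f g dk → (d + dj) * e + (f + dk) * g ≡ (dj * e + dk * g) + (d * e + f * g)
          regroup′ = solve-∀

  squeeze : ∀ {a₁ a₂ a₃ l₁ l₂ l₃ s₁ s₂ s₃} → 0 < a₁ → 0 < a₂ → 0 < a₃ →
            l₁ ≤ s₁ → l₂ ≤ s₂ → l₃ ≤ s₃ →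
            l₁ * a₁ + l₂ * a₂ + l₃ * a₃ ≡ s₁ * a₁ + s₂ * a₂ + s₃ * a₃ →
            l₁ ≡ s₁ × l₂ ≡ s₂ × l₃ ≡ s₃
  squeeze {a₁} {a₂} {a₃} {l₁} {l₂} {l₃} {s₁} {s₂} {s₃} a₁>0 a₂>0 a₃>0 l₁≤s₁ l₂≤s₂ l₃≤s₃ eq =
      ≤-antisym l₁≤s₁ (≮⇒≥ λ lt → strict
        (+-mono-<-≤ (+-mono-<-≤ (weigh-< a₁>0 lt) (weigh a₂ l₂≤s₂)) (weigh a₃ l₃≤s₃)))
    , ≤-antisym l₂≤s₂ (≮⇒≥ λ lt → strict
        (+-mono-<-≤ (+-mono-≤-< (weigh a₁ l₁≤s₁) (weigh-< a₂>0 lt)) (weigh a₃ l₃≤s₃)))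
    , ≤-antisym l₃≤s₃ (≮⇒≥ λ lt → strict
        (+-mono-≤-< (+-mono-≤ (weigh a₁ l₁≤s₁) (weigh a₂ l₂≤s₂)) (weigh-< a₃>0 lt)))
    where
      weigh : ∀ a {m n} → m ≤ n → m * a ≤ n * a
      weigh a = *-monoˡ-≤ a
      weigh-< : ∀ {a m n} → 0 < a → m < n → m * a < n * a
      weigh-< {a} a>0 = *-monoˡ-< a {{>-nonZero a>0}}
      strict : ¬ (l₁ * a₁ + l₂ * a₂ + l₃ * a₃ < s₁ * a₁ + s₂ * a₂ + s₃ * a₃)
      strict = <-irrefl eq

  record Herzog (l₁ l₂ l₃ x₁₂ x₁₃ x₂₁ x₂₃ x₃₁ x₃₂ : ℕ) : Set where
    field
      x₁₂>0 : 0 < x₁₂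
      x₁₃>0 : 0 < x₁₃
      x₂₁>0 : 0 < x₂₁
      x₂₃>0 : 0 < x₂₃
      x₃₁>0 : 0 < x₃₁
      x₃₂>0 : 0 < x₃₂
      l₁≡ : l₁ ≡ x₂₁ + x₃₁
      l₂≡ : l₂ ≡ x₁₂ + x₃₂
      l₃≡ : l₃ ≡ x₁₃ + x₂₃

  herzog : ∀ {a₁ a₂ a₃ l₁ l₂ l₃ x₁₂ x₁₃ x₂₁ x₂₃ x₃₁ x₃₂} →
           0 < a₁ → 0 < a₂ → 0 < a₃ →
           Coprime a₁ a₂ → Coprime a₁ a₃ → Coprime a₂ a₃ →
           IsMinL a₁ a₂ a₃ l₁ → IsMinL a₂ a₁ a₃ l₂ → IsMinL a₃ a₁ a₂ l₃ →
           l₁ * a₁ ≡ x₁₂ * a₂ + x₁₃ * a₃ →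
           l₂ * a₂ ≡ x₂₁ * a₁ + x₂₃ * a₃ →
           l₃ * a₃ ≡ x₃₁ * a₁ + x₃₂ * a₂ →
           2 ≤ l₁ → 2 ≤ l₂ → 2 ≤ l₃ → Herzog l₁ l₂ l₃ x₁₂ x₁₃ x₂₁ x₂₃ x₃₁ x₃₂
  herzog {a₁} {a₂} {a₃} {l₁} {l₂} {l₃} {x₁₂} {x₁₃} {x₂₁} {x₂₃} {x₃₁} {x₃₂}
         a₁>0 a₂>0 a₃>0 c₁₂ c₁₃ c₂₃ M₁ M₂ M₃ E₁ E₂ E₃ l₁≥2 l₂≥2 l₃≥2 = record
    { x₁₂>0 = x₁₂>0 ; x₁₃>0 = x₁₃>0 ; x₂₁>0 = x₂₁>0 ; x₂₃>0 = x₂₃>0 ; x₃₁>0 = x₃₁>0 ; x₃₂>0 = x₃₂>0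
    ; l₁≡ = proj₁ sums ; l₂≡ = proj₁ (proj₂ sums) ; l₃≡ = proj₂ (proj₂ sums) }
    where
      B₁ : LowerBound a₁ a₂ a₃ l₁
      B₁ = lowerBound M₁
      B₁′ : LowerBound a₁ a₃ a₂ l₁
      B₁′ = lowerBound-swap M₁
      B₂ : LowerBound a₂ a₁ a₃ l₂
      B₂ = lowerBound M₂
      B₂′ : LowerBound a₂ a₃ a₁ l₂
      B₂′ = lowerBound-swap M₂
      B₃ : LowerBound a₃ a₁ a₂ l₃
      B₃ = lowerBound M₃
      B₃′ : LowerBound a₃ a₂ a₁ l₃
      B₃′ = lowerBound-swap M₃
      E₁′ : l₁ * a₁ ≡ x₁₃ * a₃ + x₁₂ * a₂
      E₁′ = trans E₁ (+-comm (x₁₂ * a₂) (x₁₃ * a₃))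
      E₂′ : l₂ * a₂ ≡ x₂₃ * a₃ + x₂₁ * a₁
      E₂′ = trans E₂ (+-comm (x₂₁ * a₁) (x₂₃ * a₃))
      E₃′ : l₃ * a₃ ≡ x₃₂ * a₂ + x₃₁ * a₁
      E₃′ = trans E₃ (+-comm (x₃₁ * a₁) (x₃₂ * a₂))
      pos : ∀ {l} → 2 ≤ l → 0 < l
      pos = ≤-trans (s≤s z≤n)
      -- xᵢⱼ > 0 because lⱼ ≥ 2 forces lᵢ < aₖ
      x₁₂>0 : 0 < x₁₂
      x₁₂>0 = first-coef-pos {x = x₁₂} {x₁₃} (coprime-sym c₁₃) (pos l₁≥2) (l<a a₃>0 a₂>0 c₁₃ B₁′ B₂ l₂≥2) E₁
      x₁₃>0 : 0 < x₁₃
      x₁₃>0 = first-coef-pos {x = x₁₃} {x₁₂} (coprime-sym c₁₂) (pos l₁≥2) (l<a a₂>0 a₃>0 c₁₂ B₁ B₃ l₃≥2) E₁′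
      x₂₁>0 : 0 < x₂₁
      x₂₁>0 = first-coef-pos {x = x₂₁} {x₂₃} (coprime-sym c₂₃) (pos l₂≥2) (l<a a₃>0 a₁>0 c₂₃ B₂′ B₁ l₁≥2) E₂
      x₂₃>0 : 0 < x₂₃
      x₂₃>0 = first-coef-pos {x = x₂₃} {x₂₁} c₁₂ (pos l₂≥2) (l<a a₁>0 a₃>0 (coprime-sym c₁₂) B₂ B₃′ l₃≥2) E₂′
      x₃₁>0 : 0 < x₃₁
      x₃₁>0 = first-coef-pos {x = x₃₁} {x₃₂} c₂₃ (pos l₃≥2) (l<a a₂>0 a₁>0 (coprime-sym c₂₃) B₃′ B₁′ l₁≥2) E₃
      x₃₂>0 : 0 < x₃₂
      x₃₂>0 = first-coef-pos {x = x₃₂} {x₃₁} c₁₃ (pos l₃≥2) (l<a a₁>0 a₂>0 (coprime-sym c₁₃) B₃ B₂′ l₂≥2) E₃′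
      l₁≤ : l₁ ≤ x₂₁ + x₃₁
      l₁≤ = l≤x+x {xji = x₂₁} {x₂₃} {x₃₁} {x₃₂} E₂ E₃ (<⇒≤ x₃₂<l₂) (<⇒≤ x₂₃<l₃) x₂₁>0 B₁
        where
          x₃₂<l₂ : x₃₂ < l₂
          x₃₂<l₂ = x<l {xji = x₂₁} {x₂₃} {x₃₁} {x₃₂} a₁>0 E₃ E₂ x₂₁>0 x₂₃>0 B₃
          x₂₃<l₃ : x₂₃ < l₃
          x₂₃<l₃ = x<l {xji = x₃₁} {x₃₂} {x₂₁} {x₂₃} a₁>0 E₂ E₃ x₃₁>0 x₃₂>0 B₂
      l₂≤ : l₂ ≤ x₁₂ + x₃₂
      l₂≤ = l≤x+x {xji = x₁₂} {x₁₃} {x₃₂} {x₃₁} E₁ E₃′ (<⇒≤ x₃₁<l₁) (<⇒≤ x₁₃<l₃) x₁₂>0 B₂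
        where
          x₃₁<l₁ : x₃₁ < l₁
          x₃₁<l₁ = x<l {xji = x₁₂} {x₁₃} {x₃₂} {x₃₁} a₂>0 E₃′ E₁ x₁₂>0 x₁₃>0 B₃′
          x₁₃<l₃ : x₁₃ < l₃
          x₁₃<l₃ = x<l {xji = x₃₂} {x₃₁} {x₁₂} {x₁₃} a₂>0 E₁ E₃′ x₃₂>0 x₃₁>0 B₁
      l₃≤ : l₃ ≤ x₁₃ + x₂₃
      l₃≤ = l≤x+x {xji = x₁₃} {x₁₂} {x₂₃} {x₂₁} E₁′ E₂′ (<⇒≤ x₂₁<l₁) (<⇒≤ x₁₂<l₂) x₁₃>0 B₃
        where
          x₂₁<l₁ : x₂₁ < l₁
          x₂₁<l₁ = x<l {xji = x₁₃} {x₁₂} {x₂₃} {x₂₁} a₃>0 E₂′ E₁′ x₁₃>0 x₁₂>0 B₂′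
          x₁₂<l₂ : x₁₂ < l₂
          x₁₂<l₂ = x<l {xji = x₂₃} {x₂₁} {x₁₃} {x₁₂} a₃>0 E₁′ E₂′ x₂₃>0 x₂₁>0 B₁′
      total : l₁ * a₁ + l₂ * a₂ + l₃ * a₃ ≡ (x₂₁ + x₃₁) * a₁ + (x₁₂ + x₃₂) * a₂ + (x₁₃ + x₂₃) * a₃
      total = trans (cong₂ _+_ (cong₂ _+_ E₁ E₂) E₃) (regroup x₁₂ a₂ x₁₃ a₃ x₂₁ a₁ x₂₃ x₃₁ x₃₂)
        where
          regroup : ∀ x₁₂ a₂ x₁₃ a₃ x₂₁ a₁ x₂₃ x₃₁ x₃₂ →
            (x₁₂ * a₂ + x₁₃ * a₃) + (x₂₁ * a₁ + x₂₃ * a₃) + (x₃₁ * a₁ + x₃₂ * a₂)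
              ≡ (x₂₁ + x₃₁) * a₁ + (x₁₂ + x₃₂) * a₂ + (x₁₃ + x₂₃) * a₃
          regroup = solve-∀
      sums : l₁ ≡ x₂₁ + x₃₁ × l₂ ≡ x₁₂ + x₃₂ × l₃ ≡ x₁₃ + x₂₃
      sums = squeeze a₁>0 a₂>0 a₃>0 l₁≤ l₂≤ l₃≤ total


module UniqueRepresentation where

  open import Data.Nat
  open import Data.Nat.Properties
  open import Data.Nat.Divisibility using (_∣_; ∣⇒≤; ∣m+n∣m⇒∣n; n∣m*n)
  open import Data.Nat.Coprimality using (Coprime; coprime-divisor)
  open import Data.Nat.Tactic.RingSolver using (solve-∀)
  open import Data.Product using (_×_; _,_)
  open import Data.Empty using (⊥; ⊥-elim)
  open import Relation.Binary using (tri<; tri≈; tri>)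
  open import Relation.Binary.PropositionalEquality
  open Minimality using (LowerBound)

  module _ {a₁ a₂ a₃ l₁ l₃ x₁₂ x₁₃ x₂₃ : ℕ}
           (bound₁ : LowerBound a₁ a₂ a₃ l₁) (bound₃ : LowerBound a₃ a₁ a₂ l₃)
           (E₁ : l₁ * a₁ ≡ x₁₂ * a₂ + x₁₃ * a₃) (l₃≡ : l₃ ≡ x₁₃ + x₂₃)
           (x₁₃>0 : 0 < x₁₃) (x₂₃>0 : 0 < x₂₃) where

    -- No representation l₃a₃ = y₁a₁ + y₂a₂ has y₁ ≥ l₁: trading l₁a₁ for x₁₂a₂ + x₁₃a₃
    -- would put x₂₃·a₃ = (l₃ - x₁₃)·a₃ into T(a₁,a₂), although 0 < x₂₃ < l₃.
    no-rep-beyond-l₁ : ∀ {y₁ y₂} → l₁ ≤ y₁ → l₃ * a₃ ≡ y₁ * a₁ + y₂ * a₂ → ⊥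
    no-rep-beyond-l₁ {y₁} {y₂} l₁≤y₁ E with m≤n⇒∃[o]m+o≡n l₁≤y₁
    ... | d , refl = <-irrefl refl
          (<-≤-trans (subst (x₂₃ <_) (sym l₃≡) (m<n+m x₂₃ x₁₃>0)) (bound₃ x₂₃ d (x₁₂ + y₂) x₂₃>0 x₂₃·a₃∈T))
      where
        open ≡-Reasoning
        x₂₃·a₃∈T : x₂₃ * a₃ ≡ d * a₁ + (x₁₂ + y₂) * a₂
        x₂₃·a₃∈T = +-cancelˡ-≡ (x₁₃ * a₃) _ _ (begin
          x₁₃ * a₃ + x₂₃ * a₃                     ≡⟨ *-distribʳ-+ a₃ x₁₃ x₂₃ ⟨
          (x₁₃ + x₂₃) * a₃                        ≡⟨ cong (_* a₃) l₃≡ ⟨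
          l₃ * a₃                                 ≡⟨ E ⟩
          (l₁ + d) * a₁ + y₂ * a₂                 ≡⟨ split l₁ d a₁ y₂ a₂ ⟩
          l₁ * a₁ + (d * a₁ + y₂ * a₂)            ≡⟨ cong (_+ (d * a₁ + y₂ * a₂)) E₁ ⟩
          x₁₂ * a₂ + x₁₃ * a₃ + (d * a₁ + y₂ * a₂) ≡⟨ regroup x₁₂ a₂ x₁₃ a₃ d a₁ y₂ ⟩
          x₁₃ * a₃ + (d * a₁ + (x₁₂ + y₂) * a₂)   ∎)
          where
            split : ∀ l d a y b → (l + d) * a + y * b ≡ l * a + (d * a + y * b)
            split = solve-∀
            regroup : ∀ x b x′ c d a y → x * b + x′ * c + (d * a + y * b) ≡ x′ * c + (d * a + (x + y) * b)
            regroup = solve-∀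

    -- Two representations whose first coefficients differ by d > 0 have a₂ ∣ d, so d ≥ a₂ ≥ l₁.
    no-two-reps : Coprime a₂ a₁ → 0 < a₂ → ∀ {m y m′ y′} → m < m′ →
                  l₃ * a₃ ≡ m * a₁ + y * a₂ → l₃ * a₃ ≡ m′ * a₁ + y′ * a₂ → ⊥
    no-two-reps cop a₂>0 {m} {y} {m′} {y′} m<m′ E E′ with m≤n⇒∃[o]m+o≡n (<⇒≤ m<m′)
    ... | d , refl = no-rep-beyond-l₁ {y₂ = y′} (≤-trans l₁≤a₂ (≤-trans a₂≤d (m≤n+m d m))) E′
      where
        d>0 : 0 < d
        d>0 = +-cancelˡ-< m 0 d (subst (_< m + d) (sym (+-identityʳ m)) m<m′)
        l₁≤a₂ : l₁ ≤ a₂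
        l₁≤a₂ = bound₁ a₂ a₁ 0 a₂>0 (trans (*-comm a₂ a₁) (sym (+-identityʳ (a₁ * a₂))))
        same : y′ * a₂ + d * a₁ ≡ y * a₂
        same = +-cancelˡ-≡ (m * a₁) _ _ (trans (sym (split m d a₁ y′ a₂)) (trans (sym E′) E))
          where
            split : ∀ m d a y b → (m + d) * a + y * b ≡ m * a + (y * b + d * a)
            split = solve-∀
        a₂≤d : a₂ ≤ d
        a₂≤d = ∣⇒≤ {{>-nonZero d>0}} (coprime-divisor cop (subst (a₂ ∣_) (*-comm d a₁)
                 (∣m+n∣m⇒∣n (subst (a₂ ∣_) (sym same) (n∣m*n y)) (n∣m*n y′))))

    representation-unique : Coprime a₂ a₁ → 0 < a₂ → ∀ {x₃₁ x₃₂ m₁ m₂} →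
                            l₃ * a₃ ≡ x₃₁ * a₁ + x₃₂ * a₂ → l₃ * a₃ ≡ m₁ * a₁ + m₂ * a₂ →
                            m₁ ≡ x₃₁ × m₂ ≡ x₃₂
    representation-unique cop a₂>0 {x₃₁} {x₃₂} {m₁} {m₂} E₃ E with <-cmp m₁ x₃₁
    ... | tri< lt _ _ = ⊥-elim (no-two-reps cop a₂>0 {y = m₂} {y′ = x₃₂} lt E E₃)
    ... | tri> _ _ gt = ⊥-elim (no-two-reps cop a₂>0 {y = x₃₂} {y′ = m₂} gt E₃ E)
    ... | tri≈ _ refl _ =
      refl , *-cancelʳ-≡ m₂ x₃₂ a₂ {{>-nonZero a₂>0}} (+-cancelˡ-≡ (m₁ * a₁) _ _ (trans (sym E) E₃))


module Lattice where

  open import Data.Nat as ℕ using (ℕ)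
  import Data.Nat.Properties as ℕP
  import Data.Nat.Tactic.RingSolver as ℕSolver
  open import Data.Integer hiding (suc; _⊖_)
  open import Data.Integer.Properties
  open import Data.Integer.Tactic.RingSolver using (solve-∀)
  open import Data.Product using (_,_; ∃-syntax; proj₁; proj₂)
  open import Data.Sum using (_⊎_; inj₁; inj₂)
  open import Data.List using (_∷_; [])
  open import Data.List.Relation.Binary.Permutation.Propositional
    using (_↭_; ↭-refl; prep; swap; ↭-sym) renaming (trans to ↭-trans)
  open import Data.List.Relation.Binary.Permutation.Propositional.Properties using (∈-resp-↭)
  open import Function using (_∘_)
  open import Relation.Binary.PropositionalEquality
  open import Defs

  ≡³ : ∀ {x₁ x₂ x₃ y₁ y₂ y₃ : ℤ} → x₁ ≡ y₁ → x₂ ≡ y₂ → x₃ ≡ y₃ → (x₁ , x₂ , x₃) ≡ (y₁ , y₂ , y₃)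
  ≡³ refl refl refl = refl

  N : ℤ → ℤ → ℤ
  N p q = p * p + p * q + q * q

  cross-term-dominates : ∀ P Q P′ Q′ → 0 ℕ.< P′ ℕ.+ Q′ → P′ ℕ.+ Q′ ℕ.< P ℕ.+ Q →
    P′ ℕ.* P′ ℕ.+ P′ ℕ.* Q′ ℕ.+ Q′ ℕ.* Q′ ℕ.< P ℕ.* P′ ℕ.+ Q ℕ.* Q′ ℕ.+ (P ℕ.+ Q) ℕ.* (P′ ℕ.+ Q′)
  cross-term-dominates P Q P′ Q′ pos lt = begin-strict
    P′ ℕ.* P′ ℕ.+ P′ ℕ.* Q′ ℕ.+ Q′ ℕ.* Q′                ≤⟨ ℕP.m≤m+n _ (P′ ℕ.* Q′) ⟩
    P′ ℕ.* P′ ℕ.+ P′ ℕ.* Q′ ℕ.+ Q′ ℕ.* Q′ ℕ.+ P′ ℕ.* Q′  ≡⟨ square P′ Q′ ⟩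
    (P′ ℕ.+ Q′) ℕ.* (P′ ℕ.+ Q′)                          <⟨ ℕP.*-monoˡ-< (P′ ℕ.+ Q′) {{ℕ.>-nonZero pos}} lt ⟩
    (P ℕ.+ Q) ℕ.* (P′ ℕ.+ Q′)                            ≤⟨ ℕP.m≤n+m _ _ ⟩
    P ℕ.* P′ ℕ.+ Q ℕ.* Q′ ℕ.+ (P ℕ.+ Q) ℕ.* (P′ ℕ.+ Q′)  ∎
    where
      open ℕP.≤-Reasoning
      square : ∀ a b → a ℕ.* a ℕ.+ a ℕ.* b ℕ.+ b ℕ.* b ℕ.+ a ℕ.* b ≡ (a ℕ.+ b) ℕ.* (a ℕ.+ b)
      square = ℕSolver.solve-∀

  +-cancelʳ-< : ∀ {x y} c → x + c < y + c → x < y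
  +-cancelʳ-< {x} {y} c lt = subst₂ _<_ (cancel x c) (cancel y c) (+-monoˡ-< (- c) lt)
    where cancel : ∀ x c → x + c + - c ≡ x
          cancel = solve-∀

  -- Hence moving (-P,-Q) towards the origin by (P′,Q′) strictly decreases N, because (N being even)
  -- N(P′ - P, Q′ - Q) + [P P′ + Q Q′ + (P+Q)(P′+Q′)] = N(P,Q) + N(P′,Q′).
  N-decreases : ∀ P Q P′ Q′ → 0 ℕ.< P′ ℕ.+ Q′ → P′ ℕ.+ Q′ ℕ.< P ℕ.+ Q →
                N (- + P + + P′) (- + Q + + Q′) < N (- + P) (- + Q)
  N-decreases P Q P′ Q′ pos lt = +-cancelʳ-< C (begin-strict
    N (- + P + + P′) (- + Q + + Q′) + C  ≡⟨ expand (+ P) (+ Q) (+ P′) (+ Q′) ⟩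
    N (- + P) (- + Q) + N (+ P′) (+ Q′)  <⟨ +-monoʳ-< (N (- + P) (- + Q)) N<C ⟩
    N (- + P) (- + Q) + C                ∎)
    where
      open ≤-Reasoning
      C : ℤ
      C = + P * + P′ + + Q * + Q′ + (+ P + + Q) * (+ P′ + + Q′)
      expand : ∀ p q p′ q′ →
        (- p + p′) * (- p + p′) + (- p + p′) * (- q + q′) + (- q + q′) * (- q + q′)
          + (p * p′ + q * q′ + (p + q) * (p′ + q′))
        ≡ (- p) * (- p) + (- p) * (- q) + (- q) * (- q) + (p′ * p′ + p′ * q′ + q′ * q′)
      expand = solve-∀
      N<C : N (+ P′) (+ Q′) < C
      N<C = subst₂ _<_ (cast-N P′ Q′) (cast-C P Q P′ Q′) (+<+ (cross-term-dominates P Q P′ Q′ pos lt))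
        where
          cast-N : ∀ a b → + (a ℕ.* a ℕ.+ a ℕ.* b ℕ.+ b ℕ.* b) ≡ N (+ a) (+ b)
          cast-N a b = trans (pos-+ (a ℕ.* a ℕ.+ a ℕ.* b) (b ℕ.* b))
            (cong₂ _+_ (trans (pos-+ (a ℕ.* a) (a ℕ.* b)) (cong₂ _+_ (pos-* a a) (pos-* a b))) (pos-* b b))
          cast-C : ∀ a b c d → + (a ℕ.* c ℕ.+ b ℕ.* d ℕ.+ (a ℕ.+ b) ℕ.* (c ℕ.+ d))
                             ≡ + a * + c + + b * + d + (+ a + + b) * (+ c + + d)
          cast-C a b c d = trans (pos-+ (a ℕ.* c ℕ.+ b ℕ.* d) ((a ℕ.+ b) ℕ.* (c ℕ.+ d)))
            (cong₂ _+_ (trans (pos-+ (a ℕ.* c) (b ℕ.* d)) (cong₂ _+_ (pos-* a c) (pos-* b d)))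
                       (trans (pos-* (a ℕ.+ b) (c ℕ.+ d)) (cong₂ _*_ (pos-+ a b) (pos-+ c d))))

  module _ (a₁ a₂ a₃ : ℕ) where

    InL-⊕ : ∀ {v w} → InL a₁ a₂ a₃ v → InL a₁ a₂ a₃ w → InL a₁ a₂ a₃ (v ⊕ w)
    InL-⊕ {v₁ , v₂ , v₃} {w₁ , w₂ , w₃} Lv Lw =
      trans (split (+ a₁) (+ a₂) (+ a₃) v₁ v₂ v₃ w₁ w₂ w₃) (cong₂ _+_ Lv Lw)
      where
        split : ∀ A B C v₁ v₂ v₃ w₁ w₂ w₃ →
          A * (v₁ + w₁) + B * (v₂ + w₂) + C * (v₃ + w₃) ≡ (A * v₁ + B * v₂ + C * v₃) + (A * w₁ + B * w₂ + C * w₃)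
        split = solve-∀

    InL-· : ∀ k {w} → InL a₁ a₂ a₃ w → InL a₁ a₂ a₃ (k · w)
    InL-· k {w₁ , w₂ , w₃} Lw =
      trans (factor (+ a₁) (+ a₂) (+ a₃) k w₁ w₂ w₃) (trans (cong (k *_) Lw) (*-zeroʳ k))
      where
        factor : ∀ A B C k w₁ w₂ w₃ → A * (k * w₁) + B * (k * w₂) + C * (k * w₃) ≡ k * (A * w₁ + B * w₂ + C * w₃)
        factor = solve-∀

    InL-⊖ : ∀ {v w} → InL a₁ a₂ a₃ v → InL a₁ a₂ a₃ w → InL a₁ a₂ a₃ (v ⊖ w)
    InL-⊖ Lv Lw = InL-⊕ Lv (InL-· (- 1ℤ) Lw)

    -- On L the norm is 4·N(a₁x₁, a₂x₂): with p = a₁x₁, q = a₂x₂ one has a₃x₃ = -(p + q) and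
    -- |x|² = (p - q)² + 3(p + q)² = 4(p² + pq + q²).
    normSq-on-L : ∀ {w₁ w₂ w₃} → InL a₁ a₂ a₃ (w₁ , w₂ , w₃) →
                  normSq a₁ a₂ a₃ (w₁ , w₂ , w₃) ≡ + 4 * N (+ a₁ * w₁) (+ a₂ * w₂)
    normSq-on-L {w₁} {w₂} {w₃} Lw = begin
      normSq a₁ a₂ a₃ (w₁ , w₂ , w₃)                         ≡⟨ as-squares (+ a₁) (+ a₂) (+ a₃) w₁ w₂ w₃ ⟩
      (p - q) * (p - q) + + 3 * (+ a₃ * w₃) * (+ a₃ * w₃)     ≡⟨ cong (λ r → (p - q) * (p - q) + + 3 * r * r) r≡ ⟩
      (p - q) * (p - q) + + 3 * (- (p + q)) * (- (p + q))     ≡⟨ collect p q ⟩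
      + 4 * N p q                                             ∎
      where
        open ≡-Reasoning
        p = + a₁ * w₁
        q = + a₂ * w₂
        as-squares : ∀ A B C x y z →
          A * A * x * x - + 2 * A * B * x * y + B * B * y * y + + 3 * C * C * z * z
            ≡ (A * x - B * y) * (A * x - B * y) + + 3 * (C * z) * (C * z)
        as-squares = solve-∀
        collect : ∀ p q → (p - q) * (p - q) + + 3 * (- (p + q)) * (- (p + q)) ≡ + 4 * (p * p + p * q + q * q)
        collect = solve-∀
        r≡ : + a₃ * w₃ ≡ - (p + q)
        r≡ = trans (isolate p q (+ a₃ * w₃)) (trans (cong (λ s → - (p + q) + s) Lw) (+-identityʳ (- (p + q))))
          where isolate : ∀ p q r → r ≡ - (p + q) + (p + q + r)
                isolate = solve-∀

  Comb : Vec3 → Vec3 → Vec3 → Set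
  Comb g h w = ∃[ α ] ∃[ β ] w ≡ (α · g) ⊕ (β · h)

  comb-zero : ∀ {g h} → Comb g h zero3
  comb-zero {g₁ , g₂ , g₃} {h₁ , h₂ , h₃} = 0ℤ , 0ℤ , ≡³ (vanish g₁ h₁) (vanish g₂ h₂) (vanish g₃ h₃)
    where vanish : ∀ a b → 0ℤ ≡ 0ℤ * a + 0ℤ * b
          vanish = solve-∀

  comb-left : ∀ {g h} → Comb g h g
  comb-left {g₁ , g₂ , g₃} {h₁ , h₂ , h₃} = 1ℤ , 0ℤ , ≡³ (pick g₁ h₁) (pick g₂ h₂) (pick g₃ h₃)
    where pick : ∀ a b → a ≡ 1ℤ * a + 0ℤ * b
          pick = solve-∀

  comb-right : ∀ {g h} → Comb g h h
  comb-right {g₁ , g₂ , g₃} {h₁ , h₂ , h₃} = 0ℤ , 1ℤ , ≡³ (pick g₁ h₁) (pick g₂ h₂) (pick g₃ h₃)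
    where pick : ∀ a b → b ≡ 0ℤ * a + 1ℤ * b
          pick = solve-∀

  comb-⊕ : ∀ {g h v w} → Comb g h v → Comb g h w → Comb g h (v ⊕ w)
  comb-⊕ {g₁ , g₂ , g₃} {h₁ , h₂ , h₃} (α , β , refl) (γ , δ , refl) =
    α + γ , β + δ , ≡³ (add α β γ δ g₁ h₁) (add α β γ δ g₂ h₂) (add α β γ δ g₃ h₃)
    where add : ∀ α β γ δ a b → α * a + β * b + (γ * a + δ * b) ≡ (α + γ) * a + (β + δ) * b
          add = solve-∀

  comb-· : ∀ {g h} k {w} → Comb g h w → Comb g h (k · w)
  comb-· {g₁ , g₂ , g₃} {h₁ , h₂ , h₃} k (α , β , refl) =
    k * α , k * β , ≡³ (scale k α β g₁ h₁) (scale k α β g₂ h₂) (scale k α β g₃ h₃)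
    where scale : ∀ k α β a b → k * (α * a + β * b) ≡ k * α * a + k * β * b
          scale = solve-∀

  comb-⊖ : ∀ {g h w f} → Comb g h (w ⊖ f) → Comb g h f → Comb g h w
  comb-⊖ {g} {h} {w₁ , w₂ , w₃} {f₁ , f₂ , f₃} c c′ =
    subst (Comb g h) (≡³ (restore w₁ f₁) (restore w₂ f₂) (restore w₃ f₃)) (comb-⊕ c c′)
    where restore : ∀ w f → w + (- 1ℤ) * f + f ≡ w
          restore = solve-∀

  comb-neg : ∀ {g h w} → Comb g h ((- 1ℤ) · w) → Comb g h w
  comb-neg {g} {h} {w₁ , w₂ , w₃} c =
    subst (Comb g h) (≡³ (twice w₁) (twice w₂) (twice w₃)) (comb-· (- 1ℤ) c)
    where twice : ∀ w → (- 1ℤ) * ((- 1ℤ) * w) ≡ w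
          twice = solve-∀

  eliminate : ∀ {g h v} m n α β → g ≡ (m · h) ⊕ (n · v) → v ≡ (α · h) ⊕ (β · g) →
              (1ℤ - n * β) · g ≡ (m + n * α) · h
  eliminate {g₁ , g₂ , g₃} {h₁ , h₂ , h₃} {v₁ , v₂ , v₃} m n α β G V =
    ≡³ (scalar (cong proj₁ G) (cong proj₁ V))
       (scalar (cong (proj₁ ∘ proj₂) G) (cong (proj₁ ∘ proj₂) V))
       (scalar (cong (proj₂ ∘ proj₂) G) (cong (proj₂ ∘ proj₂) V))
    where
      scalar : ∀ {g h v} → g ≡ m * h + n * v → v ≡ α * h + β * g → (1ℤ - n * β) * g ≡ (m + n * α) * h
      scalar {g} {h} {v} G V = begin
        (1ℤ - n * β) * g                      ≡⟨ expand n β g ⟩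
        g - n * β * g                         ≡⟨ cong (λ t → t - n * β * g) G ⟩
        m * h + n * v - n * β * g             ≡⟨ cong (λ t → m * h + n * t - n * β * g) V ⟩
        m * h + n * (α * h + β * g) - n * β * g ≡⟨ collect m n α β g h ⟩
        (m + n * α) * h                       ∎
        where
          open ≡-Reasoning
          expand : ∀ n β g → (1ℤ - n * β) * g ≡ g - n * β * g
          expand = solve-∀
          collect : ∀ m n α β g h → m * h + n * (α * h + β * g) - n * β * g ≡ (m + n * α) * h
          collect = solve-∀

  unit-factor : ∀ n β → n * β ≡ 1ℤ → β ≡ 1ℤ ⊎ β ≡ - 1ℤ
  unit-factor n β eq with ℕP.m*n≡1⇒n≡1 ∣ n ∣ ∣ β ∣ (trans (sym (abs-* n β)) (cong ∣_∣ eq))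
  unit-factor n (+ .1)            eq | refl = inj₁ refl
  unit-factor n -[1+ ℕ.zero ]     eq | _    = inj₂ refl
  unit-factor n -[1+ ℕ.suc _ ]    eq | ()

  sameSet-↭ : ∀ {xs ys} → xs ↭ ys → SameSet xs ys
  sameSet-↭ p = (λ _ → ∈-resp-↭ p) , (λ _ → ∈-resp-↭ (↭-sym p))

  rotate₃ : ∀ {a b c : Vec3} → a ∷ b ∷ c ∷ [] ↭ b ∷ c ∷ a ∷ []
  rotate₃ {a} {b} {c} = ↭-trans (swap a b ↭-refl) (prep b (swap a c ↭-refl))

  reverse₃ : ∀ {a b c : Vec3} → a ∷ b ∷ c ∷ [] ↭ c ∷ b ∷ a ∷ []
  reverse₃ {a} {b} {c} = ↭-trans rotate₃ (swap b c ↭-refl)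

  ≡∷³ : ∀ {a b c a′ b′ c′ : Vec3} → a ≡ a′ → b ≡ b′ → c ≡ c′ → a ∷ b ∷ c ∷ [] ≡ a′ ∷ b′ ∷ c′ ∷ []
  ≡∷³ refl refl refl = refl

  third : Vec3 → ℤ
  third (_ , _ , z) = z


module Rounding where

  open import Data.Nat as ℕ using (ℕ; suc)
  open import Data.Integer hiding (suc; _/_)
  import Data.Integer as ℤ
  open import Data.Integer.Properties
  open import Data.Integer.GCD using (gcd)
  open import Data.Integer.DivMod using ([n/d]*d≤n; n<s[n/ℕd]*d; div-pos-is-/ℕ)
  open import Data.Integer.Tactic.RingSolver using (solve-∀)
  open import Data.Rational as ℚ using (ℚ; mkℚ; floor; ceiling; ↥_; ↧_; _/_)
  import Data.Rational.Properties as ℚP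
  open import Data.Product using (_×_; _,_; proj₁; proj₂)
  open import Data.Empty using (⊥; ⊥-elim)
  open import Relation.Binary using (tri<; tri≈; tri>)
  open import Relation.Binary.PropositionalEquality
  open import Defs using (ratio)

  IntegerPart : ℤ → ℤ → ℕ → Set
  IntegerPart k v d = k * + d ≤ v × v < (k + 1ℤ) * + d

  above-integerPart : ∀ {k k′ v d} → k < k′ → k′ * + d ≤ v → v < (k + 1ℤ) * + d → ⊥
  above-integerPart {k} {k′} {v} {d} k<k′ lo hi =
    <-irrefl refl (<-≤-trans hi (≤-trans (*-monoʳ-≤-nonNeg (+ d) k+1≤k′) lo))
    where
      k+1≤k′ : k + 1ℤ ≤ k′
      k+1≤k′ = subst (_≤ k′) (+-comm 1ℤ k) (i<j⇒suc[i]≤j k<k′)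

  integerPart-unique : ∀ {k k′ v d} → IntegerPart k v d → IntegerPart k′ v d → k ≡ k′
  integerPart-unique {k} {k′} (lo , hi) (lo′ , hi′) with <-cmp k k′
  ... | tri≈ _ k≡k′ _ = k≡k′
  ... | tri< k<k′ _ _ = ⊥-elim (above-integerPart k<k′ lo′ hi)
  ... | tri> _ _ k′<k = ⊥-elim (above-integerPart k′<k lo hi′)

  Represents : ℚ → ℤ → ℕ → Set
  Represents q v d = ↥ q * + d ≡ v * ↧ q

  represents-/ : ∀ v n → Represents (v / suc n) v (suc n)
  represents-/ v n = begin
    ↥ q * + suc n         ≡⟨ cong (↥ q *_) (ℚP.↧-/ v (suc n)) ⟨
    ↥ q * (↧ q * g)       ≡⟨ regroup (↥ q) (↧ q) g ⟩
    (↥ q * g) * ↧ q       ≡⟨ cong (_* ↧ q) (ℚP.↥-/ v (suc n)) ⟩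
    v * ↧ q               ∎
    where
      open ≡-Reasoning
      q : ℚ
      q = v / suc n
      g : ℤ
      g = gcd v (+ suc n)
      regroup : ∀ a b c → a * (b * c) ≡ (a * c) * b
      regroup = solve-∀

  represents-neg : ∀ {q v d} → Represents q v d → Represents (ℚ.- q) (- v) d
  represents-neg {q} {v} {d} rep = begin
    ↥ (ℚ.- q) * + d       ≡⟨ cong (_* + d) (ℚP.↥-neg q) ⟩
    - ↥ q * + d           ≡⟨ neg-distribˡ-* (↥ q) (+ d) ⟨
    - (↥ q * + d)         ≡⟨ cong -_ rep ⟩
    - (v * ↧ q)           ≡⟨ neg-distribˡ-* v (↧ q) ⟩
    - v * ↧ q             ≡⟨ cong (- v *_) (ℚP.↧-neg q) ⟨
    - v * ↧ (ℚ.- q)       ∎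
    where open ≡-Reasoning

  floor-integerPart : ∀ q v n → Represents q v (suc n) → IntegerPart (floor q) v (suc n)
  floor-integerPart (mkℚ N D _) v n rep =
      *-cancelʳ-≤-pos (F * + suc n) v (+ suc D) (subst₂ _≤_ (swap F) rep (*-monoʳ-≤-nonNeg (+ suc n) lo))
    , *-cancelʳ-<-nonNeg (+ suc D) (subst₂ _<_ rep (swap (F + 1ℤ)) (*-monoʳ-<-pos (+ suc n) hi))
    where
      F : ℤ
      F = N ℤ./ + suc D
      lo : F * + suc D ≤ N
      lo = [n/d]*d≤n N (+ suc D)
      hi : N < (F + 1ℤ) * + suc D
      hi = subst (λ z → N < z * + suc D)
             (trans (cong ℤ.suc (sym (div-pos-is-/ℕ N (suc D)))) (+-comm 1ℤ F))
             (n<s[n/ℕd]*d N (suc D))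
      swap : ∀ f → f * + suc D * + suc n ≡ f * + suc n * + suc D
      swap f = regroup f (+ suc D) (+ suc n)
        where regroup : ∀ a b c → a * b * c ≡ a * c * b
              regroup = solve-∀

  ceiling≡-floor-neg : ∀ q → ceiling q ≡ - floor (ℚ.- q)
  ceiling≡-floor-neg (mkℚ _ _ _) = refl

  rounding : ∀ {k v L} → 0 ℕ.< L → k * + L < v → v < (k + 1ℤ) * + L →
             floor (ratio v (+ L)) ≡ k × ceiling (ratio v (+ L)) ≡ k + 1ℤ
  rounding {k} {v} {suc n} _ lo hi =
      integerPart-unique (floor-integerPart q v n (represents-/ v n)) (<⇒≤ lo , hi)
    , (begin
      ceiling q                  ≡⟨ ceiling≡-floor-neg q ⟩
      - floor (ℚ.- q)            ≡⟨ cong -_ (integerPart-unique floor-neg (neg-lo , neg-hi)) ⟩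
      - (- (k + 1ℤ))             ≡⟨ neg-involutive (k + 1ℤ) ⟩
      k + 1ℤ                     ∎)
    where
      open ≡-Reasoning
      q : ℚ
      q = v / suc n
      floor-neg : IntegerPart (floor (ℚ.- q)) (- v) (suc n)
      floor-neg = floor-integerPart (ℚ.- q) (- v) n (represents-neg {q} {v} (represents-/ v n))
      neg-lo : - (k + 1ℤ) * + suc n ≤ - v
      neg-lo = subst (_≤ - v) (neg-distribˡ-* (k + 1ℤ) (+ suc n)) (neg-mono-≤ (<⇒≤ hi))
      neg-hi : - v < (- (k + 1ℤ) + 1ℤ) * + suc n
      neg-hi = subst (- v <_) (trans (neg-distribˡ-* k (+ suc n)) (cong (_* + suc n) (simplify k)))
                 (neg-mono-< lo)
        where simplify : ∀ k → - k ≡ - (k + 1ℤ) + 1ℤ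
              simplify = solve-∀

  strictly-between : ∀ {k v L a b} → 0 ℕ.< a → 0 ℕ.< b →
                     v ≡ k * + L + + b → v + + a ≡ (k + 1ℤ) * + L → k * + L < v × v < (k + 1ℤ) * + L
  strictly-between {k} {v} {L} {a} {b} a>0 b>0 lo hi =
    subst (k * + L <_) (sym lo) (grow (k * + L) b>0) , subst (v <_) hi (grow v a>0)
    where grow : ∀ t {n} → 0 ℕ.< n → t < t + + n
          grow t n>0 = subst (_< t + _) (+-identityʳ t) (+-monoʳ-< t (+<+ n>0))


module SizeStep where

  open import Data.Nat
  open import Data.Nat.Properties
  open import Data.Nat.Tactic.RingSolver using (solve-∀)
  open import Data.Integer using (_⊖_; ∣_∣)
  open import Data.Integer.Properties using (∣m⊝n∣≤m⊔n)
  open import Data.Empty using (⊥-elim)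
  open import Relation.Binary.PropositionalEquality

  ∣⊖∣≤+ : ∀ m n → ∣ m ⊖ n ∣ ≤ m + n
  ∣⊖∣≤+ m n = ≤-trans (∣m⊝n∣≤m⊔n m n) (m⊔n≤m+n m n)

  ∣⊖∣<+ : ∀ {m n} → 0 < m → 0 < n → ∣ m ⊖ n ∣ < m + n
  ∣⊖∣<+ {m} {n} m>0 n>0 = ≤-<-trans (∣m⊝n∣≤m⊔n m n) (⊔-lub (m<m+n m n>0) (m<n+m n m>0))

  -- One descent step, for a lattice vector (W, -J, -K) (coordinates ordered i, j, k) with
  -- W > 0 and the basic vector (l, -x, -y) with l ≤ W, x, y > 0: the difference has strictly
  -- smaller weighted size Σ |coordinate|·a, by the triangle inequality in the j- and k-coordinates,
  -- which is strict in a coordinate where J (resp. K) is positive.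
  size-step : ∀ {ai aj ak W J K l x y} → 0 < ai → 0 < aj → 0 < ak → 0 < W →
              W * ai ≡ J * aj + K * ak → l * ai ≡ x * aj + y * ak → l ≤ W → 0 < x → 0 < y →
              (W ∸ l) * ai + ∣ x ⊖ J ∣ * aj + ∣ y ⊖ K ∣ * ak < W * ai + J * aj + K * ak
  size-step {ai} {aj} {ak} {W} {J} {K} {l} {x} {y} ai>0 aj>0 ak>0 W>0 EW El l≤W x>0 y>0 = begin-strict
    (W ∸ l) * ai + ∣ x ⊖ J ∣ * aj + ∣ y ⊖ K ∣ * ak   ≡⟨ +-assoc ((W ∸ l) * ai) _ _ ⟩
    (W ∸ l) * ai + (∣ x ⊖ J ∣ * aj + ∣ y ⊖ K ∣ * ak) <⟨ +-monoʳ-< ((W ∸ l) * ai) (triangle J K EW) ⟩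
    (W ∸ l) * ai + ((x + J) * aj + (y + K) * ak)     ≡⟨ cong ((W ∸ l) * ai +_) (regroup x J aj y K ak) ⟩
    (W ∸ l) * ai + (x * aj + y * ak + (J * aj + K * ak)) ≡⟨ cong (λ t → (W ∸ l) * ai + (t + (J * aj + K * ak))) El ⟨
    (W ∸ l) * ai + (l * ai + (J * aj + K * ak))      ≡⟨ +-assoc ((W ∸ l) * ai) (l * ai) _ ⟨
    (W ∸ l) * ai + l * ai + (J * aj + K * ak)        ≡⟨ cong (_+ (J * aj + K * ak)) (*-distribʳ-+ ai (W ∸ l) l) ⟨
    (W ∸ l + l) * ai + (J * aj + K * ak)             ≡⟨ cong (λ t → t * ai + (J * aj + K * ak)) (m∸n+n≡m l≤W) ⟩
    W * ai + (J * aj + K * ak)                       ≡⟨ +-assoc (W * ai) _ _ ⟨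
    W * ai + J * aj + K * ak                         ∎
    where
      open ≤-Reasoning
      regroup : ∀ x J a y K b → (x + J) * a + (y + K) * b ≡ x * a + y * b + (J * a + K * b)
      regroup = solve-∀
      scale-≤ : ∀ {m n} a → m ≤ n → m * a ≤ n * a
      scale-≤ a = *-monoˡ-≤ a
      scale-< : ∀ {m n} a → 0 < a → m < n → m * a < n * a
      scale-< a a>0 = *-monoˡ-< a {{>-nonZero a>0}}
      -- W·aᵢ > 0 forces J > 0 or K > 0, which makes the triangle inequality strict
      triangle : ∀ J K → W * ai ≡ J * aj + K * ak →
                 ∣ x ⊖ J ∣ * aj + ∣ y ⊖ K ∣ * ak < (x + J) * aj + (y + K) * ak
      triangle (suc J) K _ = +-mono-<-≤ (scale-< aj aj>0 (∣⊖∣<+ x>0 z<s)) (scale-≤ ak (∣⊖∣≤+ y K))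
      triangle zero (suc K) _ = +-mono-≤-< (scale-≤ aj (∣⊖∣≤+ x 0)) (scale-< ak ak>0 (∣⊖∣<+ y>0 z<s))
      triangle zero zero W·ai≡0 = ⊥-elim (<-irrefl (sym W·ai≡0) (*-mono-< W>0 ai>0))


module CoordinateArithmetic where

  open import Data.Nat as ℕ using (ℕ; zero; suc)
  import Data.Nat.Properties as ℕP
  open import Data.Integer hiding (suc)
  open import Data.Integer.Properties
  open import Data.Integer.Tactic.RingSolver using (solve-∀)
  open import Data.Product using (_×_; _,_)
  open import Data.Empty using (⊥; ⊥-elim)
  open import Relation.Binary.PropositionalEquality

  data SignView : ℤ → Set where
    >0     : ∀ n → SignView (+ suc n)
    ≤0     : ∀ n → SignView (- + n)

  sign-view : ∀ z → SignView z
  sign-view (+ zero)  = ≤0 0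
  sign-view (+ suc n) = >0 n
  sign-view -[1+ n ]  = ≤0 (suc n)

  positive-not-≤0 : ∀ {n} → + suc n ≤ 0ℤ → ⊥
  positive-not-≤0 (+≤+ ())

  nonpositive-not->0 : ∀ n → 0ℤ < - + n → ⊥
  nonpositive-not->0 zero (+<+ ())
  nonpositive-not->0 (suc n) ()

  flip⁺ : ∀ n → - + n ≡ (- 1ℤ) * + n
  flip⁺ n = sym (-1*i≡-i (+ n))

  flip⁻ : ∀ n → + n ≡ (- 1ℤ) * (- + n)
  flip⁻ n = trans (sym (neg-involutive (+ n))) (sym (-1*i≡-i (- + n)))

  ∣-+∣ : ∀ J → ∣ - + J ∣ ≡ J
  ∣-+∣ J = ∣-i∣≡∣i∣ (+ J)

  ∣W-l∣ : ∀ {W l} → l ℕ.≤ W → ∣ + W + (- 1ℤ) * + l ∣ ≡ W ℕ.∸ l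
  ∣W-l∣ {W} {l} l≤W = cong ∣_∣ (begin
    + W + (- 1ℤ) * + l  ≡⟨ cong (λ t → + W + t) (-1*i≡-i (+ l)) ⟩
    + W - + l           ≡⟨ m-n≡m⊖n W l ⟩
    W ⊖ l               ≡⟨ ⊖-≥ l≤W ⟩
    + (W ℕ.∸ l)         ∎)
    where open ≡-Reasoning

  ∣-J+x∣ : ∀ J x → ∣ - + J + (- 1ℤ) * (- + x) ∣ ≡ ∣ x ⊖ J ∣
  ∣-J+x∣ J x = cong ∣_∣ (trans (cong (λ t → - + J + t) (sym (flip⁻ x))) (-m+n≡n⊖m J x))

  scaled : ∀ a m → + a * (- + m) ≡ - + (m ℕ.* a)
  scaled a m = trans (sym (neg-distribʳ-* (+ a) (+ m))) (cong -_ (trans (*-comm (+ a) (+ m)) (sym (pos-* m a))))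

  scaled-shift : ∀ a m x → + a * (- + m + (- 1ℤ) * (- + x)) ≡ - + (m ℕ.* a) + + (x ℕ.* a)
  scaled-shift a m x = begin
    + a * (- + m + (- 1ℤ) * (- + x))  ≡⟨ distribute (+ a) (+ m) (+ x) ⟩
    + a * (- + m) + + x * + a         ≡⟨ cong₂ _+_ (scaled a m) (sym (pos-* x a)) ⟩
    - + (m ℕ.* a) + + (x ℕ.* a)       ∎
    where
      open ≡-Reasoning
      distribute : ∀ a m x → a * (- m + (- 1ℤ) * (- x)) ≡ a * (- m) + x * a
      distribute = solve-∀

  relation⇒form : ∀ A B C W J K → W ℕ.* A ≡ J ℕ.* B ℕ.+ K ℕ.* C →
                  + A * + W + + B * (- + J) + + C * (- + K) ≡ 0ℤ
  relation⇒form A B C W J K eq = begin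
    + A * + W + + B * (- + J) + + C * (- + K)   ≡⟨ move (+ A) (+ B) (+ C) (+ W) (+ J) (+ K) ⟩
    + W * + A - (+ J * + B + + K * + C)         ≡⟨ cong (_- (+ J * + B + + K * + C)) (cast eq) ⟩
    (+ J * + B + + K * + C) - (+ J * + B + + K * + C) ≡⟨ +-inverseʳ (+ J * + B + + K * + C) ⟩
    0ℤ                                          ∎
    where
      open ≡-Reasoning
      move : ∀ A B C W J K → A * W + B * (- J) + C * (- K) ≡ W * A - (J * B + K * C)
      move = solve-∀
      cast : W ℕ.* A ≡ J ℕ.* B ℕ.+ K ℕ.* C → + W * + A ≡ + J * + B + + K * + C
      cast e = trans (sym (pos-* W A))
        (trans (cong +_ e) (trans (pos-+ (J ℕ.* B) (K ℕ.* C)) (cong₂ _+_ (pos-* J B) (pos-* K C))))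

  form⇒relation : ∀ A B C W J K → + A * + W + + B * (- + J) + + C * (- + K) ≡ 0ℤ →
                  W ℕ.* A ≡ J ℕ.* B ℕ.+ K ℕ.* C
  form⇒relation A B C W J K eq = +-injective (begin
    + (W ℕ.* A)                                 ≡⟨ pos-* W A ⟩
    + W * + A                                   ≡⟨ isolate (+ A) (+ B) (+ C) (+ W) (+ J) (+ K) ⟩
    (+ A * + W + + B * (- + J) + + C * (- + K)) + (+ J * + B + + K * + C) ≡⟨ cong (_+ (+ J * + B + + K * + C)) eq ⟩
    0ℤ + (+ J * + B + + K * + C)                ≡⟨ +-identityˡ _ ⟩
    + J * + B + + K * + C                       ≡⟨ cong₂ _+_ (pos-* J B) (pos-* K C) ⟨
    + (J ℕ.* B) + + (K ℕ.* C)                   ≡⟨ pos-+ (J ℕ.* B) (K ℕ.* C) ⟨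
    + (J ℕ.* B ℕ.+ K ℕ.* C)                     ∎)
    where
      open ≡-Reasoning
      isolate : ∀ A B C W J K → W * A ≡ (A * W + B * (- J) + C * (- K)) + (J * B + K * C)
      isolate = solve-∀

  swap-sum : ∀ x y z → x + y + z ≡ 0ℤ → y + x + z ≡ 0ℤ
  swap-sum x y z eq = trans (cong (_+ z) (+-comm y x)) eq

  rotate-sum : ∀ x y z → x + y + z ≡ 0ℤ → y + z + x ≡ 0ℤ
  rotate-sum x y z eq = trans (rotate x y z) eq
    where rotate : ∀ x y z → y + z + x ≡ x + y + z
          rotate = solve-∀

  nonpos-form⇒sum : ∀ A B C X Y Z → + A * (- + X) + + B * (- + Y) + + C * (- + Z) ≡ 0ℤ →
                    X ℕ.* A ℕ.+ Y ℕ.* B ℕ.+ Z ℕ.* C ≡ 0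
  nonpos-form⇒sum A B C X Y Z eq = +-injective (begin
    + (X ℕ.* A ℕ.+ Y ℕ.* B ℕ.+ Z ℕ.* C)                ≡⟨ pos-+ (X ℕ.* A ℕ.+ Y ℕ.* B) (Z ℕ.* C) ⟩
    + (X ℕ.* A ℕ.+ Y ℕ.* B) + + (Z ℕ.* C)              ≡⟨ cong (_+ + (Z ℕ.* C)) (pos-+ (X ℕ.* A) (Y ℕ.* B)) ⟩
    + (X ℕ.* A) + + (Y ℕ.* B) + + (Z ℕ.* C)
      ≡⟨ cong₂ _+_ (cong₂ _+_ (pos-* X A) (pos-* Y B)) (pos-* Z C) ⟩
    + X * + A + + Y * + B + + Z * + C                  ≡⟨ negate (+ A) (+ B) (+ C) (+ X) (+ Y) (+ Z) ⟩
    - (+ A * (- + X) + + B * (- + Y) + + C * (- + Z))  ≡⟨ cong -_ eq ⟩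
    0ℤ                                                 ∎)
    where
      open ≡-Reasoning
      negate : ∀ A B C X Y Z → X * A + Y * B + Z * C ≡ - (A * (- X) + B * (- Y) + C * (- Z))
      negate = solve-∀

  weights-zero : ∀ {A B C X Y Z} → 0 ℕ.< A → 0 ℕ.< B → 0 ℕ.< C →
                 X ℕ.* A ℕ.+ Y ℕ.* B ℕ.+ Z ℕ.* C ≡ 0 → X ≡ 0 × Y ≡ 0 × Z ≡ 0
  weights-zero {A} {B} {C} {X} {Y} {Z} A>0 B>0 C>0 eq =
      ℕP.m*n≡0⇒m≡0 X A {{ℕ.>-nonZero A>0}} (ℕP.m+n≡0⇒m≡0 (X ℕ.* A) XY≡0)
    , ℕP.m*n≡0⇒m≡0 Y B {{ℕ.>-nonZero B>0}} (ℕP.m+n≡0⇒n≡0 (X ℕ.* A) XY≡0)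
    , ℕP.m*n≡0⇒m≡0 Z C {{ℕ.>-nonZero C>0}} (ℕP.m+n≡0⇒n≡0 (X ℕ.* A ℕ.+ Y ℕ.* B) eq)
    where
      XY≡0 : X ℕ.* A ℕ.+ Y ℕ.* B ≡ 0
      XY≡0 = ℕP.m+n≡0⇒m≡0 (X ℕ.* A ℕ.+ Y ℕ.* B) eq

  positive-side : ∀ {A B C W J K} → 0 ℕ.< B → W ℕ.* A ≡ suc J ℕ.* B ℕ.+ K ℕ.* C → 0 ℕ.< W
  positive-side {W = suc _} _ _ = ℕ.z<s
  positive-side {A} {B} {C} {zero} {J} {K} B>0 eq =
    ⊥-elim (ℕP.<-irrefl (sym (ℕP.m+n≡0⇒m≡0 B (ℕP.m+n≡0⇒m≡0 (B ℕ.+ J ℕ.* B) (sym eq)))) B>0)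

open Minimality using (LowerBound; lowerBound)
open HerzogIdentities using (Herzog; herzog)

module Setting
  (a₁ a₂ a₃ l₁ l₂ l₃ x₁₂ x₁₃ x₂₁ x₂₃ x₃₁ x₃₂ : ℕ)
  (a₁>0 : 0 ℕ.< a₁) (a₂>0 : 0 ℕ.< a₂) (a₃>0 : 0 ℕ.< a₃)
  (bound₁ : LowerBound a₁ a₂ a₃ l₁) (bound₂ : LowerBound a₂ a₁ a₃ l₂) (bound₃ : LowerBound a₃ a₁ a₂ l₃)
  (E₁ : l₁ ℕ.* a₁ ≡ x₁₂ ℕ.* a₂ ℕ.+ x₁₃ ℕ.* a₃)
  (E₂ : l₂ ℕ.* a₂ ≡ x₂₁ ℕ.* a₁ ℕ.+ x₂₃ ℕ.* a₃)
  (E₃ : l₃ ℕ.* a₃ ≡ x₃₁ ℕ.* a₁ ℕ.+ x₃₂ ℕ.* a₂)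
  (H : Herzog l₁ l₂ l₃ x₁₂ x₁₃ x₂₁ x₂₃ x₃₁ x₃₂)
  where

  import Data.Nat.Properties as ℕP
  open import Data.Nat as ℕ using (zero; suc; z<s)
  open import Data.Nat.Coprimality using (Coprime)
  open import Data.Integer hiding (suc; _⊖_)
  open import Data.Integer using () renaming (_⊖_ to _⊖ℤ_)
  open import Data.Integer.Properties
  open import Data.Integer.Tactic.RingSolver using (solve-∀)
  open import Data.Rational using (floor; ceiling)
  open import Data.Product using (_×_; _,_; proj₁; proj₂; ∃-syntax)
  open import Data.Sum using (_⊎_; inj₁; inj₂)
  open import Data.List using (_∷_; [])
  open import Data.Empty using (⊥; ⊥-elim)
  open import Function using (_∘_)
  open import Relation.Binary.PropositionalEquality
  open import Defs
  open UniqueRepresentation using (representation-unique)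
  open Lattice
  open Rounding using (rounding; strictly-between)
  open SizeStep using (size-step)
  open CoordinateArithmetic
  open Herzog H

  f₁ f₂ f₃ : Vec3
  f₁ = (+ l₁ , - (+ x₁₂) , - (+ x₁₃))
  f₂ = (- (+ x₂₁) , + l₂ , - (+ x₂₃))
  f₃ = (- (+ x₃₁) , - (+ x₃₂) , + l₃)

  InL₀ : Vec3 → Set
  InL₀ = InL a₁ a₂ a₃

  pattern₁⁺ : ∀ {W J K} → W ℕ.* a₁ ≡ J ℕ.* a₂ ℕ.+ K ℕ.* a₃ → InL₀ (+ W , - + J , - + K)
  pattern₁⁺ {W} {J} {K} = relation⇒form a₁ a₂ a₃ W J K

  pattern₂⁺ : ∀ {W J K} → W ℕ.* a₂ ≡ J ℕ.* a₁ ℕ.+ K ℕ.* a₃ → InL₀ (- + J , + W , - + K)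
  pattern₂⁺ {W} {J} {K} eq =
    swap-sum (+ a₂ * + W) (+ a₁ * - + J) (+ a₃ * - + K) (relation⇒form a₂ a₁ a₃ W J K eq)

  pattern₃⁺ : ∀ {W J K} → W ℕ.* a₃ ≡ J ℕ.* a₁ ℕ.+ K ℕ.* a₂ → InL₀ (- + J , - + K , + W)
  pattern₃⁺ {W} {J} {K} eq =
    rotate-sum (+ a₃ * + W) (+ a₁ * - + J) (+ a₂ * - + K) (relation⇒form a₃ a₁ a₂ W J K eq)

  pattern₁⁻ : ∀ {W J K} → InL₀ (+ W , - + J , - + K) → W ℕ.* a₁ ≡ J ℕ.* a₂ ℕ.+ K ℕ.* a₃
  pattern₁⁻ {W} {J} {K} = form⇒relation a₁ a₂ a₃ W J K

  pattern₂⁻ : ∀ {W J K} → InL₀ (- + J , + W , - + K) → W ℕ.* a₂ ≡ J ℕ.* a₁ ℕ.+ K ℕ.* a₃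
  pattern₂⁻ {W} {J} {K} L =
    form⇒relation a₂ a₁ a₃ W J K (swap-sum (+ a₁ * - + J) (+ a₂ * + W) (+ a₃ * - + K) L)

  pattern₃⁻ : ∀ {W J K} → InL₀ (- + J , - + K , + W) → W ℕ.* a₃ ≡ J ℕ.* a₁ ℕ.+ K ℕ.* a₂
  pattern₃⁻ {W} {J} {K} L = form⇒relation a₃ a₁ a₂ W J K
    (rotate-sum (+ a₂ * - + K) (+ a₃ * + W) (+ a₁ * - + J)
      (rotate-sum (+ a₁ * - + J) (+ a₂ * - + K) (+ a₃ * + W) L))

  f₁∈L : InL₀ f₁
  f₁∈L = pattern₁⁺ E₁

  f₂∈L : InL₀ f₂
  f₂∈L = pattern₂⁺ E₂

  f₃∈L : InL₀ f₃
  f₃∈L = pattern₃⁺ E₃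

  +l₁≡ : + l₁ ≡ + x₂₁ + + x₃₁
  +l₁≡ = trans (cong +_ l₁≡) (pos-+ x₂₁ x₃₁)

  +l₂≡ : + l₂ ≡ + x₁₂ + + x₃₂
  +l₂≡ = trans (cong +_ l₂≡) (pos-+ x₁₂ x₃₂)

  +l₃≡ : + l₃ ≡ + x₁₃ + + x₂₃
  +l₃≡ = trans (cong +_ l₃≡) (pos-+ x₁₃ x₂₃)

  -- l₃ > 0, needed to divide by u₃ = l₃.
  l₃>0 : 0 ℕ.< l₃
  l₃>0 = subst (0 ℕ.<_) (sym l₃≡) (ℕP.<-≤-trans x₁₃>0 (ℕP.m≤m+n x₁₃ x₂₃))

  f₂≡ : f₂ ≡ ((- 1ℤ) · f₃) ⊕ ((- 1ℤ) · f₁)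
  f₂≡ = ≡³
    (trans (coord₁ (+ x₂₁) (+ x₃₁)) (cong (λ t → (- 1ℤ) * (- + x₃₁) + (- 1ℤ) * t) (sym +l₁≡)))
    (trans +l₂≡ (coord₂ (+ x₁₂) (+ x₃₂)))
    (trans (coord₃ (+ x₁₃) (+ x₂₃)) (cong (λ t → (- 1ℤ) * t + (- 1ℤ) * (- + x₁₃)) (sym +l₃≡)))
    where
      coord₁ : ∀ a b → - a ≡ (- 1ℤ) * (- b) + (- 1ℤ) * (a + b)
      coord₁ = solve-∀
      coord₂ : ∀ a b → a + b ≡ (- 1ℤ) * (- b) + (- 1ℤ) * (- a)
      coord₂ = solve-∀
      coord₃ : ∀ a b → - b ≡ (- 1ℤ) * (a + b) + (- 1ℤ) * (- a)
      coord₃ = solve-∀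

  f₁-comb : Comb f₃ f₁ f₁
  f₁-comb = comb-right

  f₂-comb : Comb f₃ f₁ f₂
  f₂-comb = subst (Comb f₃ f₁) (sym f₂≡) (comb-⊕ (comb-· (- 1ℤ) comb-left) (comb-· (- 1ℤ) comb-right))

  f₃-comb : Comb f₃ f₁ f₃
  f₃-comb = comb-left

  size : Vec3 → ℕ
  size (w₁ , w₂ , w₃) = ∣ w₁ ∣ ℕ.* a₁ ℕ.+ ∣ w₂ ∣ ℕ.* a₂ ℕ.+ ∣ w₃ ∣ ℕ.* a₃

  weigh : ∀ {p₁ p₂ p₃ q₁ q₂ q₃} → p₁ ≡ q₁ → p₂ ≡ q₂ → p₃ ≡ q₃ →
          p₁ ℕ.* a₁ ℕ.+ p₂ ℕ.* a₂ ℕ.+ p₃ ℕ.* a₃ ≡ q₁ ℕ.* a₁ ℕ.+ q₂ ℕ.* a₂ ℕ.+ q₃ ℕ.* a₃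
  weigh refl refl refl = refl

  descend₁ : ∀ {W J K} → 0 ℕ.< W → InL₀ (+ W , - + J , - + K) →
             size ((+ W , - + J , - + K) ⊖ f₁) ℕ.< size (+ W , - + J , - + K)
  descend₁ {W} {J} {K} W>0 L =
    subst₂ ℕ._<_ (weigh (sym (∣W-l∣ l₁≤W)) (sym (∣-J+x∣ J x₁₂)) (sym (∣-J+x∣ K x₁₃)))
                 (weigh (refl {x = W}) (sym (∣-+∣ J)) (sym (∣-+∣ K)))
                 (size-step {W = W} {J} {K} {l₁} {x₁₂} {x₁₃} a₁>0 a₂>0 a₃>0 W>0 R E₁ l₁≤W x₁₂>0 x₁₃>0)
    where
      R : W ℕ.* a₁ ≡ J ℕ.* a₂ ℕ.+ K ℕ.* a₃
      R = pattern₁⁻ L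
      l₁≤W : l₁ ℕ.≤ W
      l₁≤W = bound₁ W J K W>0 R

  descend₂ : ∀ {W J K} → 0 ℕ.< W → InL₀ (- + J , + W , - + K) →
             size ((- + J , + W , - + K) ⊖ f₂) ℕ.< size (- + J , + W , - + K)
  descend₂ {W} {J} {K} W>0 L =
    subst₂ ℕ._<_
      (trans (swap ((W ℕ.∸ l₂) ℕ.* a₂) (∣ x₂₁ ⊖ℤ J ∣ ℕ.* a₁) (∣ x₂₃ ⊖ℤ K ∣ ℕ.* a₃))
             (weigh (sym (∣-J+x∣ J x₂₁)) (sym (∣W-l∣ l₂≤W)) (sym (∣-J+x∣ K x₂₃))))
      (trans (swap (W ℕ.* a₂) (J ℕ.* a₁) (K ℕ.* a₃)) (weigh (sym (∣-+∣ J)) (refl {x = W}) (sym (∣-+∣ K))))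
      (size-step {W = W} {J} {K} {l₂} {x₂₁} {x₂₃} a₂>0 a₁>0 a₃>0 W>0 R E₂ l₂≤W x₂₁>0 x₂₃>0)
    where
      R : W ℕ.* a₂ ≡ J ℕ.* a₁ ℕ.+ K ℕ.* a₃
      R = pattern₂⁻ L
      l₂≤W : l₂ ℕ.≤ W
      l₂≤W = bound₂ W J K W>0 R
      swap : ∀ p q r → p ℕ.+ q ℕ.+ r ≡ q ℕ.+ p ℕ.+ r
      swap p q r = cong (ℕ._+ r) (ℕP.+-comm p q)

  descend₃ : ∀ {W J K} → 0 ℕ.< W → InL₀ (- + J , - + K , + W) →
             size ((- + J , - + K , + W) ⊖ f₃) ℕ.< size (- + J , - + K , + W)
  descend₃ {W} {J} {K} W>0 L =
    subst₂ ℕ._<_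
      (trans (rotate ((W ℕ.∸ l₃) ℕ.* a₃) (∣ x₃₁ ⊖ℤ J ∣ ℕ.* a₁) (∣ x₃₂ ⊖ℤ K ∣ ℕ.* a₂))
             (weigh (sym (∣-J+x∣ J x₃₁)) (sym (∣-J+x∣ K x₃₂)) (sym (∣W-l∣ l₃≤W))))
      (trans (rotate (W ℕ.* a₃) (J ℕ.* a₁) (K ℕ.* a₂)) (weigh (sym (∣-+∣ J)) (sym (∣-+∣ K)) (refl {x = W})))
      (size-step {W = W} {J} {K} {l₃} {x₃₁} {x₃₂} a₃>0 a₁>0 a₂>0 W>0 R E₃ l₃≤W x₃₁>0 x₃₂>0)
    where
      R : W ℕ.* a₃ ≡ J ℕ.* a₁ ℕ.+ K ℕ.* a₂
      R = pattern₃⁻ L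
      l₃≤W : l₃ ℕ.≤ W
      l₃≤W = bound₃ W J K W>0 R
      rotate : ∀ p q r → p ℕ.+ q ℕ.+ r ≡ q ℕ.+ r ℕ.+ p
      rotate p q r = trans (ℕP.+-assoc p q r) (ℕP.+-comm p (q ℕ.+ r))

  Generated : ℕ → Set
  Generated N = ∀ w → InL₀ w → size w ℕ.< N → Comb f₃ f₁ w

  reduce-by : ∀ {N w f} → Generated N → InL₀ f → Comb f₃ f₁ f → InL₀ w →
              size (w ⊖ f) ℕ.< size w → size w ℕ.≤ N → Comb f₃ f₁ w
  reduce-by IH Lf cf Lw smaller w≤N =
    comb-⊖ (IH _ (InL-⊖ a₁ a₂ a₃ Lw Lf) (ℕP.<-≤-trans smaller w≤N)) cf

  size-neg : ∀ w → size ((- 1ℤ) · w) ≡ size w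
  size-neg (w₁ , w₂ , w₃) = weigh (∣-1*∣ w₁) (∣-1*∣ w₂) (∣-1*∣ w₃)
    where ∣-1*∣ : ∀ z → ∣ (- 1ℤ) * z ∣ ≡ ∣ z ∣
          ∣-1*∣ z = trans (cong ∣_∣ (-1*i≡-i z)) (∣-i∣≡∣i∣ z)

  by-negation : ∀ {N w w′} → w′ ≡ (- 1ℤ) · w → InL₀ w → size w ℕ.≤ N →
                (InL₀ w′ → size w′ ℕ.≤ N → Comb f₃ f₁ w′) → Comb f₃ f₁ w
  by-negation {N} {w} refl Lw w≤N generate =
    comb-neg (generate (InL-· a₁ a₂ a₃ (- 1ℤ) Lw) (subst (ℕ._≤ N) (sym (size-neg w)) w≤N))

  nonpos-zero : ∀ {J₁ J₂ J₃} → InL₀ (- + J₁ , - + J₂ , - + J₃) → J₁ ≡ 0 × J₂ ≡ 0 × J₃ ≡ 0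
  nonpos-zero {J₁} {J₂} {J₃} L = weights-zero a₁>0 a₂>0 a₃>0 (nonpos-form⇒sum a₁ a₂ a₃ J₁ J₂ J₃ L)

  -- One descent step, by the sign pattern of w: a vector with exactly one positive coordinate i
  -- is reduced by fᵢ; one with exactly one negative coordinate is negated first (its positive
  -- coordinate is then positive by the relation); all coordinates ≤ 0 means w = 0, all > 0 is
  -- impossible.
  generated-step : ∀ {N} → Generated N → ∀ w → InL₀ w → size w ℕ.≤ N → Comb f₃ f₁ w
  generated-step IH (w₁ , w₂ , w₃) Lw w≤N with sign-view w₁ | sign-view w₂ | sign-view w₃
  ... | ≤0 J₁ | ≤0 J₂ | ≤0 J₃ = at-zero (nonpos-zero Lw)
    where at-zero : J₁ ≡ 0 × J₂ ≡ 0 × J₃ ≡ 0 → Comb f₃ f₁ (- + J₁ , - + J₂ , - + J₃)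
          at-zero (refl , refl , refl) = comb-zero
  ... | >0 W | ≤0 J | ≤0 K = reduce-by IH f₁∈L f₁-comb Lw (descend₁ z<s Lw) w≤N
  ... | ≤0 J | >0 W | ≤0 K = reduce-by IH f₂∈L f₂-comb Lw (descend₂ z<s Lw) w≤N
  ... | ≤0 J | ≤0 K | >0 W = reduce-by IH f₃∈L f₃-comb Lw (descend₃ z<s Lw) w≤N
  ... | >0 J | >0 K | ≤0 W =
    by-negation (≡³ (flip⁺ (suc J)) (flip⁺ (suc K)) (flip⁻ W)) Lw w≤N λ L′ w′≤N →
      reduce-by IH f₃∈L f₃-comb L′
        (descend₃ (positive-side {C = a₂} {J = J} {K = suc K} a₁>0 (pattern₃⁻ L′)) L′) w′≤N
  ... | >0 J | ≤0 W | >0 K =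
    by-negation (≡³ (flip⁺ (suc J)) (flip⁻ W) (flip⁺ (suc K))) Lw w≤N λ L′ w′≤N →
      reduce-by IH f₂∈L f₂-comb L′
        (descend₂ (positive-side {C = a₃} {J = J} {K = suc K} a₁>0 (pattern₂⁻ L′)) L′) w′≤N
  ... | ≤0 W | >0 J | >0 K =
    by-negation (≡³ (flip⁻ W) (flip⁺ (suc J)) (flip⁺ (suc K))) Lw w≤N λ L′ w′≤N →
      reduce-by IH f₁∈L f₁-comb L′
        (descend₁ (positive-side {C = a₃} {J = J} {K = suc K} a₂>0 (pattern₁⁻ L′)) L′) w′≤N
  ... | >0 J₁ | >0 J₂ | >0 J₃ = ⊥-elim (suc≢0 (proj₁ (nonpos-zero L′)))
    where
      L′ : InL₀ (- + suc J₁ , - + suc J₂ , - + suc J₃)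
      L′ = subst InL₀ (sym (≡³ (flip⁺ (suc J₁)) (flip⁺ (suc J₂)) (flip⁺ (suc J₃)))) (InL-· a₁ a₂ a₃ (- 1ℤ) Lw)
      suc≢0 : suc J₁ ≢ 0
      suc≢0 ()

  generated-below : ∀ N → Generated N
  generated-below (suc N) w Lw w<N = generated-step (generated-below N) w Lw (ℕP.≤-pred w<N)

  generated : ∀ w → InL₀ w → Comb f₃ f₁ w
  generated w Lw = generated-below (suc (size w)) w Lw (ℕP.n<1+n (size w))

  -- If l₃ < m₃, subtracting f₃ from u = (-m₁, -m₂, m₃) ∈ L makes it strictly shorter
  -- (`N-decreases` with P = m₁a₁, Q = m₂a₂, P′ = x₃₁a₁, Q′ = x₃₂a₂, so P′ + Q′ = l₃a₃ < m₃a₃ = P + Q).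
  shorter-by-f₃ : ∀ {m₁ m₂ m₃} → InL₀ (- + m₁ , - + m₂ , + m₃) → l₃ ℕ.< m₃ →
                  normSq a₁ a₂ a₃ ((- + m₁ , - + m₂ , + m₃) ⊖ f₃) < normSq a₁ a₂ a₃ (- + m₁ , - + m₂ , + m₃)
  shorter-by-f₃ {m₁} {m₂} {m₃} L l₃<m₃ = begin-strict
    normSq a₁ a₂ a₃ (u ⊖ f₃)                         ≡⟨ normSq-on-L a₁ a₂ a₃ (InL-⊖ a₁ a₂ a₃ L f₃∈L) ⟩
    + 4 * N (+ a₁ * (- + m₁ + (- 1ℤ) * (- + x₃₁))) (+ a₂ * (- + m₂ + (- 1ℤ) * (- + x₃₂)))
      ≡⟨ cong₂ (λ p q → + 4 * N p q) (scaled-shift a₁ m₁ x₃₁) (scaled-shift a₂ m₂ x₃₂) ⟩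
    + 4 * N (- + P + + P′) (- + Q + + Q′)
      <⟨ *-monoˡ-<-pos (+ 4) (N-decreases P Q P′ Q′ P′+Q′>0 P′+Q′<P+Q) ⟩
    + 4 * N (- + P) (- + Q)                          ≡⟨ cong₂ (λ p q → + 4 * N p q) (scaled a₁ m₁) (scaled a₂ m₂) ⟨
    + 4 * N (+ a₁ * (- + m₁)) (+ a₂ * (- + m₂))      ≡⟨ normSq-on-L a₁ a₂ a₃ L ⟨
    normSq a₁ a₂ a₃ u                                ∎
    where
      open ≤-Reasoning
      u : Vec3
      u = (- + m₁ , - + m₂ , + m₃)
      P Q P′ Q′ : ℕ
      P = m₁ ℕ.* a₁
      Q = m₂ ℕ.* a₂
      P′ = x₃₁ ℕ.* a₁
      Q′ = x₃₂ ℕ.* a₂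
      P′+Q′<P+Q : P′ ℕ.+ Q′ ℕ.< P ℕ.+ Q
      P′+Q′<P+Q = subst₂ ℕ._<_ E₃ (pattern₃⁻ L) (ℕP.*-monoˡ-< a₃ {{ℕ.>-nonZero a₃>0}} l₃<m₃)
      P′+Q′>0 : 0 ℕ.< P′ ℕ.+ Q′
      P′+Q′>0 = subst (0 ℕ.<_) E₃ (ℕP.*-mono-< l₃>0 a₃>0)

  Shortest : Vec3 → Set
  Shortest u = ∀ w → InL₀ w → w ≢ zero3 → normSq a₁ a₂ a₃ u ≤ normSq a₁ a₂ a₃ w

  -- A shortest vector (u₁, u₂, u₃) of L with u₁, u₂ ≤ 0 < u₃ is f₃: its third coordinate is at
  -- least l₃ by minimality and at most l₃ since otherwise u - f₃ would be shorter; the first two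
  -- are then fixed by the uniqueness of the representation of l₃a₃ in T(a₁,a₂).
  shortest-is-f₃ : Coprime a₂ a₁ → ∀ {u₁ u₂ u₃} → u₁ ≤ 0ℤ → u₂ ≤ 0ℤ → 0ℤ < u₃ →
                   InL₀ (u₁ , u₂ , u₃) → Shortest (u₁ , u₂ , u₃) → (u₁ , u₂ , u₃) ≡ f₃
  shortest-is-f₃ cop {u₁} {u₂} {u₃} u₁≤0 u₂≤0 u₃>0 L short with sign-view u₁ | sign-view u₂ | sign-view u₃
  ... | >0 _ | _ | _ = ⊥-elim (positive-not-≤0 u₁≤0)
  ... | _ | >0 _ | _ = ⊥-elim (positive-not-≤0 u₂≤0)
  ... | _ | _ | ≤0 n = ⊥-elim (nonpositive-not->0 n u₃>0)
  ... | ≤0 m₁ | ≤0 m₂ | >0 m =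
    ≡³ (cong (λ t → - + t) (proj₁ same-rep)) (cong (λ t → - + t) (proj₂ same-rep)) (cong +_ m₃≡l₃)
    where
      m₃ : ℕ
      m₃ = suc m
      R : m₃ ℕ.* a₃ ≡ m₁ ℕ.* a₁ ℕ.+ m₂ ℕ.* a₂
      R = pattern₃⁻ L
      f₃-shortens : l₃ ℕ.< m₃ → ⊥
      f₃-shortens l₃<m₃ = <⇒≱ (shorter-by-f₃ L l₃<m₃) (short _ (InL-⊖ a₁ a₂ a₃ L f₃∈L) nonzero)
        where
          nonzero : (- + m₁ , - + m₂ , + m₃) ⊖ f₃ ≢ zero3
          nonzero eq = ℕP.<-irrefl (sym (trans (sym (∣W-l∣ (ℕP.<⇒≤ l₃<m₃))) (cong (∣_∣ ∘ proj₂ ∘ proj₂) eq)))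
                                    (ℕP.m<n⇒0<n∸m l₃<m₃)
      m₃≡l₃ : m₃ ≡ l₃
      m₃≡l₃ = ℕP.≤-antisym (ℕP.≮⇒≥ f₃-shortens) (bound₃ m₃ m₁ m₂ z<s R)
      same-rep : m₁ ≡ x₃₁ × m₂ ≡ x₃₂
      same-rep = representation-unique {x₁₂ = x₁₂} bound₁ bound₃ E₁ l₃≡ x₁₃>0 x₂₃>0 cop a₂>0 {x₃₁} {x₃₂} {m₁} {m₂}
                   E₃ (subst (λ t → t ℕ.* a₃ ≡ m₁ ℕ.* a₁ ℕ.+ m₂ ℕ.* a₂) m₃≡l₃ R)

  -- The (1,3)-minor of f₁, f₃ is l₁l₃ - x₃₁x₁₃ = x₂₁x₁₃ + x₂₁x₂₃ + x₃₁x₂₃ > 0.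
  minor : ℤ
  minor = + l₁ * + l₃ - (- + x₃₁) * (- + x₁₃)

  minor>0 : 0ℤ < minor
  minor>0 = subst (0ℤ <_) (sym (trans (cong₂ (λ p q → p * q - (- + x₃₁) * (- + x₁₃)) +l₁≡ +l₃≡)
                                   (expand (+ x₂₁) (+ x₃₁) (+ x₁₃) (+ x₂₃))))
              (+-mono-<-≤ (+-mono-≤-< (nonneg {x₂₁} {x₁₃}) middle>0) (nonneg {x₃₁} {x₂₃}))
    where
      expand : ∀ a b c d → (a + b) * (c + d) - (- b) * (- c) ≡ a * c + a * d + b * d
      expand = solve-∀
      nonneg : ∀ {m n} → 0ℤ ≤ + m * + n
      nonneg {m} {n} = subst (0ℤ ≤_) (pos-* m n) (+≤+ ℕ.z≤n)
      middle>0 : 0ℤ < + x₂₁ * + x₂₃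
      middle>0 = subst (0ℤ <_) (pos-* x₂₁ x₂₃) (+<+ (ℕP.*-mono-< x₂₁>0 x₂₃>0))

  independent : ∀ {c d} → c · f₁ ≡ d · f₃ → c ≡ 0ℤ
  independent {c} {d} eq = resolve (i*j≡0⇒i≡0∨j≡0 c c·minor≡0)
    where
      open ≡-Reasoning
      c·minor≡0 : c * minor ≡ 0ℤ
      c·minor≡0 = begin
        c * (+ l₁ * + l₃ - (- + x₃₁) * (- + x₁₃))        ≡⟨ regroup c (+ l₁) (+ l₃) (- + x₃₁) (- + x₁₃) ⟩
        (c * + l₁) * + l₃ - (- + x₃₁) * (c * (- + x₁₃))  ≡⟨ cong₂ (λ p q → p * + l₃ - (- + x₃₁) * q)
                                                                (cong proj₁ eq) (cong (proj₂ ∘ proj₂) eq) ⟩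
        (d * (- + x₃₁)) * + l₃ - (- + x₃₁) * (d * + l₃)  ≡⟨ cancel d (- + x₃₁) (+ l₃) ⟩
        0ℤ                                               ∎
        where
          regroup : ∀ c A B C D → c * (A * B - C * D) ≡ (c * A) * B - C * (c * D)
          regroup = solve-∀
          cancel : ∀ d C B → (d * C) * B - C * (d * B) ≡ 0ℤ
          cancel = solve-∀
      resolve : c ≡ 0ℤ ⊎ minor ≡ 0ℤ → c ≡ 0ℤ
      resolve (inj₁ c≡0) = c≡0
      resolve (inj₂ minor≡0) = ⊥-elim (<-irrefl (sym minor≡0) minor>0)

  SolutionBasis : Vec3 → Vec3 → Set
  SolutionBasis u v =
    ∃[ ε₁ ] ∃[ ε₂ ] ∃[ ε₃ ] IsSign ε₁ × IsSign ε₂ × IsSign ε₃ ×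
      SameSet (u ∷ (v ⊖ (ceiling λ′ · u)) ∷ (v ⊖ (floor λ′ · u)) ∷ [])
              ((ε₁ · f₁) ∷ (ε₂ · f₂) ∷ (ε₃ · f₃) ∷ [])
    where λ′ = ratio (third v) (third u)

  f₃≡1·f₃ : f₃ ≡ 1ℤ · f₃
  f₃≡1·f₃ = ≡³ (sym (*-identityˡ _)) (sym (*-identityˡ _)) (sym (*-identityˡ _))

  -- v = α·f₃ + f₁: then ⌈λ⌉ = α and ⌊λ⌋ = α - 1, so v₋ = f₁ and v₊ = f₃ + f₁ = -f₂.
  case-plus : ∀ {v} α → v ≡ (α · f₃) ⊕ (1ℤ · f₁) → SolutionBasis f₃ v
  case-plus α refl = 1ℤ , - 1ℤ , 1ℤ , inj₁ refl , inj₂ refl , inj₁ refl ,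
    subst (λ xs → SameSet xs ((1ℤ · f₁) ∷ ((- 1ℤ) · f₂) ∷ (1ℤ · f₃) ∷ []))
          (sym (≡∷³ f₃≡1·f₃ v₋≡ v₊≡)) (sameSet-↭ rotate₃)
    where
      v : Vec3
      v = (α · f₃) ⊕ (1ℤ · f₁)
      rounded : floor (ratio (third v) (+ l₃)) ≡ α - 1ℤ × ceiling (ratio (third v) (+ l₃)) ≡ α - 1ℤ + 1ℤ
      rounded = rounding {k = α - 1ℤ} {v = third v} l₃>0 (proj₁ bounds) (proj₂ bounds)
        where
          lower : third v ≡ (α - 1ℤ) * + l₃ + + x₂₃
          lower = trans (cong (λ L → α * L + 1ℤ * (- + x₁₃)) +l₃≡)
                    (trans (split α (+ x₁₃) (+ x₂₃)) (cong (λ L → (α - 1ℤ) * L + + x₂₃) (sym +l₃≡)))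
            where split : ∀ α X Y → α * (X + Y) + 1ℤ * (- X) ≡ (α - 1ℤ) * (X + Y) + Y
                  split = solve-∀
          upper : third v + + x₁₃ ≡ (α - 1ℤ + 1ℤ) * + l₃
          upper = complete α (+ l₃) (+ x₁₃)
            where complete : ∀ α L X → α * L + 1ℤ * (- X) + X ≡ (α - 1ℤ + 1ℤ) * L
                  complete = solve-∀
          bounds : (α - 1ℤ) * + l₃ < third v × third v < (α - 1ℤ + 1ℤ) * + l₃
          bounds = strictly-between {k = α - 1ℤ} {L = l₃} {a = x₁₃} {b = x₂₃} x₁₃>0 x₂₃>0 lower upper
      v₋≡ : v ⊖ (ceiling (ratio (third v) (+ l₃)) · f₃) ≡ 1ℤ · f₁
      v₋≡ = trans (cong (λ k → v ⊖ (k · f₃)) (proj₂ rounded))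
              (≡³ (drop α (- + x₃₁) (+ l₁)) (drop α (- + x₃₂) (- + x₁₂)) (drop α (+ l₃) (- + x₁₃)))
        where drop : ∀ α p q → α * p + 1ℤ * q + (- 1ℤ) * ((α - 1ℤ + 1ℤ) * p) ≡ 1ℤ * q
              drop = solve-∀
      v₊≡ : v ⊖ (floor (ratio (third v) (+ l₃)) · f₃) ≡ (- 1ℤ) · f₂
      v₊≡ = trans (cong (λ k → v ⊖ (k · f₃)) (proj₁ rounded))
              (trans (≡³ (keep α (- + x₃₁) (+ l₁)) (keep α (- + x₃₂) (- + x₁₂)) (keep α (+ l₃) (- + x₁₃)))
                     (cong ((- 1ℤ) ·_) (sym f₂≡)))
        where keep : ∀ α p q → α * p + 1ℤ * q + (- 1ℤ) * ((α - 1ℤ) * p) ≡ (- 1ℤ) * ((- 1ℤ) * p + (- 1ℤ) * q)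
              keep = solve-∀

  -- v = α·f₃ - f₁: then ⌈λ⌉ = α + 1 and ⌊λ⌋ = α, so v₋ = -f₃ - f₁ = f₂ and v₊ = -f₁.
  case-minus : ∀ {v} α → v ≡ (α · f₃) ⊕ ((- 1ℤ) · f₁) → SolutionBasis f₃ v
  case-minus α refl = - 1ℤ , 1ℤ , 1ℤ , inj₂ refl , inj₁ refl , inj₁ refl ,
    subst (λ xs → SameSet xs (((- 1ℤ) · f₁) ∷ (1ℤ · f₂) ∷ (1ℤ · f₃) ∷ []))
          (sym (≡∷³ f₃≡1·f₃ v₋≡ v₊≡)) (sameSet-↭ reverse₃)
    where
      v : Vec3
      v = (α · f₃) ⊕ ((- 1ℤ) · f₁)
      rounded : floor (ratio (third v) (+ l₃)) ≡ α × ceiling (ratio (third v) (+ l₃)) ≡ α + 1ℤ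
      rounded = rounding {k = α} {v = third v} l₃>0 (proj₁ bounds) (proj₂ bounds)
        where
          lower : third v ≡ α * + l₃ + + x₁₃
          lower = flip α (+ l₃) (+ x₁₃)
            where flip : ∀ α L X → α * L + (- 1ℤ) * (- X) ≡ α * L + X
                  flip = solve-∀
          upper : third v + + x₂₃ ≡ (α + 1ℤ) * + l₃
          upper = trans (cong (λ L → α * L + (- 1ℤ) * (- + x₁₃) + + x₂₃) +l₃≡)
                    (trans (complete α (+ x₁₃) (+ x₂₃)) (cong ((α + 1ℤ) *_) (sym +l₃≡)))
            where complete : ∀ α X Y → α * (X + Y) + (- 1ℤ) * (- X) + Y ≡ (α + 1ℤ) * (X + Y)
                  complete = solve-∀
          bounds : α * + l₃ < third v × third v < (α + 1ℤ) * + l₃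
          bounds = strictly-between {k = α} {L = l₃} {a = x₂₃} {b = x₁₃} x₂₃>0 x₁₃>0 lower upper
      v₋≡ : v ⊖ (ceiling (ratio (third v) (+ l₃)) · f₃) ≡ 1ℤ · f₂
      v₋≡ = trans (cong (λ k → v ⊖ (k · f₃)) (proj₂ rounded))
              (trans (≡³ (merge α (- + x₃₁) (+ l₁)) (merge α (- + x₃₂) (- + x₁₂)) (merge α (+ l₃) (- + x₁₃)))
                     (cong (1ℤ ·_) (sym f₂≡)))
        where merge : ∀ α p q → α * p + (- 1ℤ) * q + (- 1ℤ) * ((α + 1ℤ) * p) ≡ 1ℤ * ((- 1ℤ) * p + (- 1ℤ) * q)
              merge = solve-∀
      v₊≡ : v ⊖ (floor (ratio (third v) (+ l₃)) · f₃) ≡ (- 1ℤ) · f₁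
      v₊≡ = trans (cong (λ k → v ⊖ (k · f₃)) (proj₁ rounded))
              (≡³ (drop α (- + x₃₁) (+ l₁)) (drop α (- + x₃₂) (- + x₁₂)) (drop α (+ l₃) (- + x₁₃)))
        where drop : ∀ α p q → α * p + (- 1ℤ) * q + (- 1ℤ) * (α * p) ≡ (- 1ℤ) * q
              drop = solve-∀

  -- With u = f₃ and (u, v) generating L: v = α·f₃ + β·f₁ by the descent, and f₁ = m·f₃ + n·v;
  -- independence of f₁, f₃ forces nβ = 1, i.e. β = ±1, which are the two cases above.
  solution-basis : ∀ {u v} → u ≡ f₃ → InL₀ v →
                   (∀ w → InL₀ w → ∃[ m ] ∃[ n ] w ≡ (m · u) ⊕ (n · v)) → SolutionBasis u v
  solution-basis {v = v} refl Lv generates = by-cases (generated v Lv) (generates f₁ f₁∈L)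
    where
      by-cases : Comb f₃ f₁ v → Comb f₃ v f₁ → SolutionBasis f₃ v
      by-cases (α , β , V) (m , n , F) = by-sign (unit-factor n β nβ≡1)
        where
          nβ≡1 : n * β ≡ 1ℤ
          nβ≡1 = sym (i-j≡0⇒i≡j 1ℤ (n * β) (independent {d = m + n * α} (eliminate m n α β F V)))
          V′ : ∀ {b} → β ≡ b → v ≡ (α · f₃) ⊕ (b · f₁)
          V′ β≡b = subst (λ b → v ≡ (α · f₃) ⊕ (b · f₁)) β≡b V
          by-sign : β ≡ 1ℤ ⊎ β ≡ - 1ℤ → SolutionBasis f₃ v
          by-sign (inj₁ β≡1) = case-plus α (V′ β≡1)
          by-sign (inj₂ β≡-1) = case-minus α (V′ β≡-1)

open import Defs
open import Data.Nat.Coprimality using (Coprime) renaming (sym to coprime-sym)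
open import Data.Integer as ℤ using (ℤ; +_; -_; _≤_; _<_; 0ℤ)
open import Data.Rational as ℚ using (floor; ceiling)
open import Data.Product using (_×_; _,_; ∃-syntax)
open import Data.List using (_∷_; [])

theorem7 :
    (a₁ a₂ a₃ : ℕ) → 0 ℕ.< a₁ → 0 ℕ.< a₂ → 0 ℕ.< a₃ →
    Coprime a₁ a₂ → Coprime a₁ a₃ → Coprime a₂ a₃ →
    (l₁ l₂ l₃ x₁₂ x₁₃ x₂₁ x₂₃ x₃₁ x₃₂ : ℕ) →
    IsMinL a₁ a₂ a₃ l₁ → IsMinL a₂ a₁ a₃ l₂ → IsMinL a₃ a₁ a₂ l₃ →
    l₁ ℕ.* a₁ ≡ x₁₂ ℕ.* a₂ ℕ.+ x₁₃ ℕ.* a₃ →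
    l₂ ℕ.* a₂ ≡ x₂₁ ℕ.* a₁ ℕ.+ x₂₃ ℕ.* a₃ →
    l₃ ℕ.* a₃ ≡ x₃₁ ℕ.* a₁ ℕ.+ x₃₂ ℕ.* a₂ →
    2 ℕ.≤ l₁ → 2 ℕ.≤ l₂ → 2 ℕ.≤ l₃ →
    (u₁ u₂ u₃ v₁ v₂ v₃ : ℤ) →
    IsReducedBasis a₁ a₂ a₃ (u₁ , u₂ , u₃) (v₁ , v₂ , v₃) →
    u₁ ≤ 0ℤ → u₂ ≤ 0ℤ → 0ℤ < u₃ →
    let u = (u₁ , u₂ , u₃)
        v = (v₁ , v₂ , v₃)
        lam = ratio v₃ u₃
        v₋ = v ⊖ (ceiling lam · u)
        v₊ = v ⊖ (floor lam · u)
        f₁ = (+ l₁ , - (+ x₁₂) , - (+ x₁₃))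
        f₂ = (- (+ x₂₁) , + l₂ , - (+ x₂₃))
        f₃ = (- (+ x₃₁) , - (+ x₃₂) , + l₃)
    in ∃[ ε₁ ] ∃[ ε₂ ] ∃[ ε₃ ]
         IsSign ε₁ × IsSign ε₂ × IsSign ε₃ ×
         SameSet (u ∷ v₋ ∷ v₊ ∷ []) ((ε₁ · f₁) ∷ (ε₂ · f₂) ∷ (ε₃ · f₃) ∷ [])
theorem7 a₁ a₂ a₃ a₁>0 a₂>0 a₃>0 c₁₂ c₁₃ c₂₃ l₁ l₂ l₃ x₁₂ x₁₃ x₂₁ x₂₃ x₃₁ x₃₂ M₁ M₂ M₃ E₁ E₂ E₃ l₁≥2 l₂≥2 l₃≥2
         u₁ u₂ u₃ v₁ v₂ v₃ ((Lu , Lv , generates , _) , _ , shortest , _) u₁≤0 u₂≤0 u₃>0 =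
  solution-basis (shortest-is-f₃ (coprime-sym c₁₂) u₁≤0 u₂≤0 u₃>0 Lu shortest) Lv generates
  where
    open Setting a₁ a₂ a₃ l₁ l₂ l₃ x₁₂ x₁₃ x₂₁ x₂₃ x₃₁ x₃₂ a₁>0 a₂>0 a₃>0
                 (lowerBound M₁) (lowerBound M₂) (lowerBound M₃) E₁ E₂ E₃
                 (herzog a₁>0 a₂>0 a₃>0 c₁₂ c₁₃ c₂₃ M₁ M₂ M₃ E₁ E₂ E₃ l₁≥2 l₂≥2 l₃≥2)
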